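{- Let $\pi$ be a set partition of $[n]$ all of whose blocks have odd size. For every set composition $\psi$ of $[n]$ such that each block of $\psi$ is a union of blocks of $\pi$, $$\sum_{\phi}(-1)^{\ell(\phi)}=2^{\ell(\pi)-\ell(\psi)}(-1)^{\ell(\pi)},$$ where the sum is over all set compositions $\phi=\phi_1|\cdots|\phi_{\ell(\phi)}$ of $[n]$ such that each block of $\phi$ is a union of blocks of $\pi$, $|\phi_{\ell(\phi)}|$ is odd, and $\psi\le\mathrm{Odd}(\phi)$.
   Context: $[n]=\{1,\dots,n\}$. A set partition has $\ell(\pi)$ blocks; a set composition $\phi=\phi_1|\cdots|\phi_\ell$ of $[n]$ is a sequence of pairwise disjoint nonempty sets with union $[n]$, $\ell(\phi)=\ell$. For set compositions, $\psi\le\phi$ means each block of $\psi$ is a union of consecutive blocks of $\phi$. For a set composition $\phi$ whose last block has odd size, $\mathrm{Odd}(\phi)$ is the set composition obtained by merging (taking unions of) each maximal run of consecutive blocks whose sizes have the parity pattern (even, ..., even, odd); e.g. $\mathrm{Odd}(1|58|69|4|23|7)=1|45689|237$. -}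

module Defs where

open import Data.Bool using (Bool; true; false; if_then_else_; _∧_; not; T)
open import Data.Nat as ℕ using (ℕ; zero; suc; _∸_; _≡ᵇ_; _≤ᵇ_; _<ᵇ_)
open import Data.Nat.Base using (_%_)
open import Data.Fin as Fin using (Fin; toℕ)
open import Data.Vec using (Vec; []; _∷_; lookup; map)
open import Data.List as List using (List; []; _∷_; allFin; upTo; concatMap; filter)
open import Data.Bool.ListAction using (all; any)
open import Data.Integer as ℤ using (ℤ; +_; -1ℤ; 0ℤ)
open import Data.Product using (Σ; _,_; proj₁; proj₂)

-- A set composition φ = φ₁|⋯|φ_ℓ of [n] (with [n] ≅ Fin n) is encoded as a
-- pair (ℓ , v) where v : Vec (Fin ℓ) n assigns to each element x the index
-- of the block containing it, subject to surjectivity (every block nonempty).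
Labelling : ℕ → Set
Labelling n = Σ ℕ (λ ℓ → Vec (Fin ℓ) n)

len : ∀ {n} → Labelling n → ℕ
len = proj₁

blk : ∀ {n} → (φ : Labelling n) → Fin n → Fin (len φ)
blk (ℓ , v) x = lookup v x

_==_ : ∀ {k} → Fin k → Fin k → Bool
i == j = toℕ i ≡ᵇ toℕ j

surjective? : ∀ {n} → Labelling n → Bool
surjective? {n} φ = all (λ j → any (λ x → blk φ x == j) (allFin n)) (allFin (len φ))

IsSetComposition : ∀ {n} → Labelling n → Set
IsSetComposition φ = T (surjective? φ)

blockSize : ∀ {n} → (φ : Labelling n) → Fin (len φ) → ℕ
blockSize {n} φ j = List.length (filter (λ x → T? (blk φ x == j)) (allFin n))
  where
  open import Relation.Nullary.Decidable using (Dec; yes; no)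
  T? : (b : Bool) → Dec (T b)
  T? true = yes _
  T? false = no (λ ())

isOdd : ℕ → Bool
isOdd m = m % 2 ≡ᵇ 1

-- A set partition π of [n] is represented by a set composition (an arbitrary
-- ordering of its blocks); ℓ(π) = len π.  All blocks of odd size:
allBlocksOdd? : ∀ {n} → Labelling n → Bool
allBlocksOdd? π = all (λ j → isOdd (blockSize π j)) (allFin (len π))

unionOfBlocks? : ∀ {n} → Labelling n → Labelling n → Bool
unionOfBlocks? {n} π φ =
  all (λ x → all (λ y → not (blk π x == blk π y) Data.Bool.∨ (blk φ x == blk φ y)) (allFin n)) (allFin n)
  where import Data.Bool

lastBlockOdd? : ∀ {n} → Labelling n → Bool
lastBlockOdd? (zero , v) = false
lastBlockOdd? (suc k , v) = isOdd (blockSize (suc k , v) (Fin.fromℕ k))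

oddBefore : ∀ {n} → (φ : Labelling n) → ℕ → ℕ
oddBefore φ m =
  List.length (filter (λ j → T? ((toℕ j <ᵇ m) ∧ isOdd (blockSize φ j))) (allFin (len φ)))
  where
  open import Relation.Nullary.Decidable using (Dec; yes; no)
  T? : (b : Bool) → Dec (T b)
  T? true = yes _
  T? false = no (λ ())

-- clamp r into Fin (suc m) (only used when r ≤ m, where it is the identity)
clamp : ℕ → (m : ℕ) → Fin (suc m)
clamp zero m = Fin.zero
clamp (suc r) zero = Fin.zero
clamp (suc r) (suc m) = Fin.suc (clamp r m)

-- Odd(φ), for φ = φ₁|⋯|φ_{k+1} whose last block is odd: merge each maximal
-- run (even,…,even,odd).  Block j of φ goes to run number
-- #{ i < j : |φ_i| odd }; the number of runs is 1 + #{ i < k : |φ_i| odd }.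
-- (For ℓ(φ) = 0 Odd is undefined; we return φ unchanged, never used.)
Odd : ∀ {n} → Labelling n → Labelling n
Odd (zero , v) = (zero , v)
Odd (suc k , v) =
  (suc (oddBefore (suc k , v) k)
  , map (λ j → clamp (oddBefore (suc k , v) (toℕ j)) (oddBefore (suc k , v) k)) v)

allVecs : (k n : ℕ) → List (Vec (Fin k) n)
allVecs k zero = [] ∷ []
allVecs k (suc n) = concatMap (λ v → List.map (_∷ v) (allFin k)) (allVecs k n)

monotone? : ∀ {a b} → Vec (Fin b) a → Bool
monotone? {a} g =
  all (λ i → all (λ j → not (toℕ i ≤ᵇ toℕ j) Data.Bool.∨ (toℕ (lookup g i) ≤ᵇ toℕ (lookup g j))) (allFin a)) (allFin a)
  where import Data.Bool

-- ψ ≤ χ : each block of ψ is a union of consecutive blocks of χ, i.e.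
-- ψ is obtained from χ by a weakly increasing map g on block indices.
refinedBy? : ∀ {n} → Labelling n → Labelling n → Bool
refinedBy? {n} ψ χ =
  any (λ g → monotone? g ∧ all (λ x → blk ψ x == lookup g (blk χ x)) (allFin n))
      (allVecs (len ψ) (len χ))

_≤SC_ : ∀ {n} → Labelling n → Labelling n → Set
ψ ≤SC χ = T (refinedBy? ψ χ)

-- all set compositions of [n] (they have at most n blocks)
setCompositions : (n : ℕ) → List (Labelling n)
setCompositions n =
  concatMap (λ ℓ → List.map (λ v → (ℓ , v))
                     (List.filter (λ v → T? (surjective? (ℓ , v))) (allVecs ℓ n)))
            (upTo (suc n))
  where
  open import Relation.Nullary.Decidable using (Dec; yes; no)
  T? : (b : Bool) → Dec (T b)
  T? true = yes _
  T? false = no (λ ())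

sumℤ : List ℤ → ℤ
sumℤ = List.foldr ℤ._+_ 0ℤ

summand? : ∀ {n} → Labelling n → Labelling n → Labelling n → Bool
summand? π ψ φ = unionOfBlocks? π φ ∧ lastBlockOdd? φ ∧ refinedBy? ψ (Odd φ)

lhsSum : ∀ {n} → Labelling n → Labelling n → ℤ
lhsSum {n} π ψ =
  sumℤ (List.map (λ φ → if summand? π ψ φ then -1ℤ ℤ.^ len φ else 0ℤ) (setCompositions n))

module Submission where

-- A set composition φ whose blocks are unions of blocks of π is a surjection w
-- from the ℓ(π) blocks of π onto the blocks of φ, and since the blocks of π
-- have odd size, |φ_j| is odd iff φ_j contains an odd number of blocks of π.
-- Recording each block of φ by its ψ-label and its parity, "last block odd and
-- ψ ≤ Odd(φ)" says that the labels weakly increase and change only right after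
-- an odd block.  The signed count of these surjections is computed by induction
-- on ℓ(π): a block b of π either joins an existing block of φ, flipping its
-- parity, or forms a new singleton block, changing the sign.  Comparing
-- insertions with flips, adding b multiplies the count by -2 if its ψ-label
-- already occurs and by -1 otherwise, whence 2^(ℓ(π)-ℓ(ψ)) (-1)^ℓ(π).

open import Defs
open import Algebra.Bundles using (CommutativeRing)
import Algebra.Properties.Semiring.Sum as SemiringSum
open import Data.Bool using (Bool; true; false; if_then_else_; _∧_; _∨_; not; T; _xor_)
import Data.Bool.Properties as BP
open import Data.Bool.ListAction using (all; any; or)
open import Data.Empty using (⊥-elim)
open import Data.Fin as Fin using (Fin; toℕ; fromℕ; punchIn)
import Data.Fin.Properties as FP
open import Data.Integer using (ℤ; +_; -1ℤ; 0ℤ; 1ℤ; _+_; _*_; -_; _-_; _^_)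
import Data.Integer.Properties as ℤP
open import Data.Integer.Tactic.RingSolver using (solve-∀)
open import Data.List as List using (List; []; _∷_; _++_; concatMap; filter; applyUpTo; upTo)
import Data.List.Properties as LP
open import Data.Nat as ℕ using (ℕ; zero; suc; _∸_; _≡ᵇ_; _≤ᵇ_; _<ᵇ_; _<_; _≤_; z≤n; s≤s; _⊓_)
import Data.Nat.Properties as ℕP
import Data.Nat.DivMod as DM
open import Data.Product using (Σ; _×_; _,_; proj₁; proj₂; ∃)
open import Data.Vec using (Vec; []; _∷_; lookup; map; tabulate)
import Data.Vec.Properties as VP
open import Relation.Binary.PropositionalEquality
  using (_≡_; _≢_; refl; sym; trans; cong; cong₂; subst; subst₂; module ≡-Reasoning)
open import Relation.Nullary using (¬_; Dec; yes; no)
open import Relation.Binary.Definitions using (tri<; tri≈; tri>)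

open SemiringSum ℤP.+-*-semiring
  using (sum-syntax; sum-cong-≗; ∑-distrib-+; ∑-comm; *-distribˡ-sum; sum-replicate-zero; sum-init-last)

𝟙 : Bool → ℤ
𝟙 true = 1ℤ
𝟙 false = 0ℤ

𝟙-∧ : ∀ x y → 𝟙 (x ∧ y) ≡ 𝟙 x * 𝟙 y
𝟙-∧ true y = sym (ℤP.*-identityˡ (𝟙 y))
𝟙-∧ false y = refl

𝟙-∧-middle : ∀ x y z → 𝟙 (x ∧ (y ∧ z)) ≡ 𝟙 y * 𝟙 (x ∧ z)
𝟙-∧-middle true y z = 𝟙-∧ y z
𝟙-∧-middle false y z = sym (ℤP.*-zeroʳ (𝟙 y))

𝟙-not-∨ : ∀ x y → 𝟙 (not (x ∨ y)) ≡ 𝟙 (not x) * 𝟙 (not y)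
𝟙-not-∨ true y = refl
𝟙-not-∨ false y = sym (ℤP.*-identityˡ _)

sum-delta : ∀ {k} (a : Fin k) (f : Fin k → ℤ) → ∑[ i < k ] (𝟙 (i == a) * f i) ≡ f a
sum-delta {suc k} Fin.zero f = trans (cong₂ _+_ (ℤP.*-identityˡ (f Fin.zero)) (sum-replicate-zero k)) (ℤP.+-identityʳ _)
sum-delta {suc k} (Fin.suc a) f = trans (ℤP.+-identityˡ _) (sum-delta a (λ i → f (Fin.suc i)))

sum-punchIn : ∀ {k} (a : Fin (suc k)) (f : Fin (suc k) → ℤ) →
  ∑[ c < suc k ] (𝟙 (not (c == a)) * f c) ≡ ∑[ c < k ] f (punchIn a c)
sum-punchIn {k} Fin.zero f = trans (ℤP.+-identityˡ _) (sum-cong-≗ (λ c → ℤP.*-identityˡ (f (Fin.suc c))))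
sum-punchIn {suc k} (Fin.suc a) f = cong₂ _+_ (ℤP.*-identityˡ (f Fin.zero)) (sum-punchIn a (λ c → f (Fin.suc c)))

sumVecs : (k n : ℕ) → (Vec (Fin k) n → ℤ) → ℤ
sumVecs k zero h = h []
sumVecs k (suc n) h = ∑[ a < k ] sumVecs k n (λ v → h (a ∷ v))

sumVecs-cong : ∀ k n {f g : Vec (Fin k) n → ℤ} → (∀ v → f v ≡ g v) → sumVecs k n f ≡ sumVecs k n g
sumVecs-cong k zero e = e []
sumVecs-cong k (suc n) e = sum-cong-≗ (λ a → sumVecs-cong k n (λ v → e (a ∷ v)))

sumVecs-+ : ∀ k n (f g : Vec (Fin k) n → ℤ) → sumVecs k n (λ v → f v + g v) ≡ sumVecs k n f + sumVecs k n g
sumVecs-+ k zero f g = refl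
sumVecs-+ k (suc n) f g = trans (sum-cong-≗ (λ a → sumVecs-+ k n (λ v → f (a ∷ v)) (λ v → g (a ∷ v))))
  (∑-distrib-+ (λ a → sumVecs k n (λ v → f (a ∷ v))) (λ a → sumVecs k n (λ v → g (a ∷ v))))

sumVecs-* : ∀ k n c (f : Vec (Fin k) n → ℤ) → sumVecs k n (λ v → c * f v) ≡ c * sumVecs k n f
sumVecs-* k zero c f = refl
sumVecs-* k (suc n) c f = trans (sum-cong-≗ (λ a → sumVecs-* k n c (λ v → f (a ∷ v))))
  (sym (*-distribˡ-sum c (λ a → sumVecs k n (λ v → f (a ∷ v)))))

sumVecs-neg : ∀ k n (f : Vec (Fin k) n → ℤ) → sumVecs k n (λ v → - f v) ≡ - sumVecs k n f
sumVecs-neg k n f = begin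
  sumVecs k n (λ v → - f v)        ≡⟨ sumVecs-cong k n (λ v → sym (ℤP.-1*i≡-i (f v))) ⟩
  sumVecs k n (λ v → -1ℤ * f v)    ≡⟨ sumVecs-* k n -1ℤ f ⟩
  -1ℤ * sumVecs k n f              ≡⟨ ℤP.-1*i≡-i _ ⟩
  - sumVecs k n f                  ∎
  where open ≡-Reasoning

sumVecs-zero : ∀ k n → sumVecs k n (λ _ → 0ℤ) ≡ 0ℤ
sumVecs-zero k zero = refl
sumVecs-zero k (suc n) = trans (sum-cong-≗ {n = k} {y = λ _ → 0ℤ} (λ a → sumVecs-zero k n)) (sum-replicate-zero k)

sum-sumVecs-comm : ∀ m k n (f : Fin m → Vec (Fin k) n → ℤ) →
  ∑[ i < m ] sumVecs k n (f i) ≡ sumVecs k n (λ v → ∑[ i < m ] f i v)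
sum-sumVecs-comm m k zero f = refl
sum-sumVecs-comm m k (suc n) f = trans (∑-comm (λ i a → sumVecs k n (λ v → f i (a ∷ v))))
  (sum-cong-≗ (λ a → sum-sumVecs-comm m k n (λ i v → f i (a ∷ v))))

sumVecs-comm : ∀ k n k′ n′ (f : Vec (Fin k) n → Vec (Fin k′) n′ → ℤ) →
  sumVecs k n (λ v → sumVecs k′ n′ (f v)) ≡ sumVecs k′ n′ (λ w → sumVecs k n (λ v → f v w))
sumVecs-comm k zero k′ n′ f = refl
sumVecs-comm k (suc n) k′ n′ f = trans (sum-cong-≗ (λ a → sumVecs-comm k n k′ n′ (λ v → f (a ∷ v))))
  (sum-sumVecs-comm k k′ n′ (λ a w → sumVecs k n (λ v → f (a ∷ v) w)))

T⇒≡true : ∀ {b} → T b → b ≡ true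
T⇒≡true {true} _ = refl

≡true⇒T : ∀ {b} → b ≡ true → T b
≡true⇒T refl = _

¬T⇒≡false : ∀ {b} → ¬ T b → b ≡ false
¬T⇒≡false {true} n = ⊥-elim (n _)
¬T⇒≡false {false} n = refl

true≢false : true ≢ false
true≢false ()

true-iff⇒≡ : ∀ x y → (x ≡ true → y ≡ true) → (y ≡ true → x ≡ true) → x ≡ y
true-iff⇒≡ true true f g = refl
true-iff⇒≡ true false f g = sym (f refl)
true-iff⇒≡ false true f g = g refl
true-iff⇒≡ false false f g = refl

∧≡true⇒ˡ : ∀ x y → x ∧ y ≡ true → x ≡ true
∧≡true⇒ˡ true y h = refl

∧≡true⇒ʳ : ∀ x y → x ∧ y ≡ true → y ≡ true
∧≡true⇒ʳ true y h = h

≤⇒≤ᵇ≡true : ∀ {m n} → m ≤ n → (m ≤ᵇ n) ≡ true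
≤⇒≤ᵇ≡true p = T⇒≡true (ℕP.≤⇒≤ᵇ p)

≤ᵇ≡true⇒≤ : ∀ {m n} → (m ≤ᵇ n) ≡ true → m ≤ n
≤ᵇ≡true⇒≤ {m} {n} h = ℕP.≤ᵇ⇒≤ m n (≡true⇒T h)

>⇒≤ᵇ≡false : ∀ {m n} → n < m → (m ≤ᵇ n) ≡ false
>⇒≤ᵇ≡false {m} {n} p = ¬T⇒≡false (λ t → ℕP.<⇒≱ p (ℕP.≤ᵇ⇒≤ m n t))

≡ᵇ-refl : ∀ m → (m ≡ᵇ m) ≡ true
≡ᵇ-refl m = T⇒≡true (ℕP.≡⇒≡ᵇ m m refl)

≡ᵇ≡true⇒≡ : ∀ {m n} → (m ≡ᵇ n) ≡ true → m ≡ n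
≡ᵇ≡true⇒≡ {m} {n} h = ℕP.≡ᵇ⇒≡ m n (≡true⇒T h)

≢⇒≡ᵇ≡false : ∀ {m n} → m ≢ n → (m ≡ᵇ n) ≡ false
≢⇒≡ᵇ≡false {m} {n} p = ¬T⇒≡false (λ t → p (ℕP.≡ᵇ⇒≡ m n t))

==-refl : ∀ {k} (i : Fin k) → (i == i) ≡ true
==-refl i = ≡ᵇ-refl (toℕ i)

==⇒≡ : ∀ {k} (i j : Fin k) → (i == j) ≡ true → i ≡ j
==⇒≡ i j h = FP.toℕ-injective (≡ᵇ≡true⇒≡ h)

≢⇒==false : ∀ {k} {i j : Fin k} → i ≢ j → (i == j) ≡ false
≢⇒==false ne = ≢⇒≡ᵇ≡false (λ e → ne (FP.toℕ-injective e))

==-sym : ∀ {k} (i j : Fin k) → (i == j) ≡ (j == i)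
==-sym i j = true-iff⇒≡ (i == j) (j == i)
  (λ h → subst (λ z → (z == i) ≡ true) (==⇒≡ i j h) (==-refl i))
  (λ h → subst (λ z → (z == j) ≡ true) (==⇒≡ j i h) (==-refl j))

==-punchIn : ∀ {k} (a : Fin (suc k)) (x j : Fin k) → (punchIn a x == punchIn a j) ≡ (x == j)
==-punchIn a x j = true-iff⇒≡ (punchIn a x == punchIn a j) (x == j)
  (λ h → subst (λ z → (x == z) ≡ true) (FP.punchIn-injective a x j (==⇒≡ _ _ h)) (==-refl x))
  (λ h → subst (λ z → (punchIn a x == punchIn a z) ≡ true) (==⇒≡ x j h) (==-refl (punchIn a x)))

punchIn-==-pivot : ∀ {k} (a : Fin (suc k)) (x : Fin k) → (punchIn a x == a) ≡ false
punchIn-==-pivot a x = ≢⇒==false (FP.punchInᵢ≢i a x)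

pivot-==-punchIn : ∀ {k} (a : Fin (suc k)) (x : Fin k) → (a == punchIn a x) ≡ false
pivot-==-punchIn a x = trans (==-sym a (punchIn a x)) (punchIn-==-pivot a x)

allᶠ : (k : ℕ) → (Fin k → Bool) → Bool
allᶠ zero P = true
allᶠ (suc k) P = P Fin.zero ∧ allᶠ k (λ j → P (Fin.suc j))

anyᶠ : (k : ℕ) → (Fin k → Bool) → Bool
anyᶠ zero P = false
anyᶠ (suc k) P = P Fin.zero ∨ anyᶠ k (λ j → P (Fin.suc j))

allᶠ⇒ : ∀ k P → allᶠ k P ≡ true → ∀ j → P j ≡ true
allᶠ⇒ (suc k) P h Fin.zero = ∧≡true⇒ˡ _ _ h
allᶠ⇒ (suc k) P h (Fin.suc j) = allᶠ⇒ k _ (∧≡true⇒ʳ (P Fin.zero) _ h) j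

⇒allᶠ : ∀ k P → (∀ j → P j ≡ true) → allᶠ k P ≡ true
⇒allᶠ zero P h = refl
⇒allᶠ (suc k) P h rewrite h Fin.zero = ⇒allᶠ k _ (λ j → h (Fin.suc j))

anyᶠ⇒ : ∀ k P → anyᶠ k P ≡ true → ∃ λ j → P j ≡ true
anyᶠ⇒ (suc k) P h with P Fin.zero in e
... | true = Fin.zero , e
... | false with anyᶠ⇒ k _ h
... | j , e′ = Fin.suc j , e′

⇒anyᶠ : ∀ k P j → P j ≡ true → anyᶠ k P ≡ true
⇒anyᶠ (suc k) P Fin.zero h rewrite h = refl
⇒anyᶠ (suc k) P (Fin.suc j) h with P Fin.zero
... | true = refl
... | false = ⇒anyᶠ k _ j h

allᶠ-cong : ∀ k {P Q : Fin k → Bool} → (∀ j → P j ≡ Q j) → allᶠ k P ≡ allᶠ k Q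
allᶠ-cong zero e = refl
allᶠ-cong (suc k) e = cong₂ _∧_ (e Fin.zero) (allᶠ-cong k (λ j → e (Fin.suc j)))

allᶠ-punchIn : ∀ k a P → allᶠ (suc k) P ≡ P a ∧ allᶠ k (λ j → P (punchIn a j))
allᶠ-punchIn k Fin.zero P = refl
allᶠ-punchIn (suc k) (Fin.suc a) P =
  trans (cong (P Fin.zero ∧_) (allᶠ-punchIn k a (λ j → P (Fin.suc j)))) (∧-swap (P Fin.zero) (P (Fin.suc a)) _)
  where
  ∧-swap : ∀ x y z → x ∧ (y ∧ z) ≡ y ∧ (x ∧ z)
  ∧-swap true y z = refl
  ∧-swap false true z = refl
  ∧-swap false false z = refl

occurs : ∀ {k n} → Fin k → Vec (Fin k) n → Bool
occurs a [] = false
occurs a (x ∷ v) = (x == a) ∨ occurs a v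

occurs-lookup : ∀ {k n} (w : Vec (Fin k) n) x → occurs (lookup w x) w ≡ true
occurs-lookup (a ∷ w) Fin.zero rewrite ==-refl a = refl
occurs-lookup (a ∷ w) (Fin.suc x) with a == lookup w x
... | true = refl
... | false = occurs-lookup w x

occurs⇒ : ∀ {k n} j (w : Vec (Fin k) n) → occurs j w ≡ true → ∃ λ x → lookup w x ≡ j
occurs⇒ j (a ∷ w) h with a == j in e
... | true = Fin.zero , ==⇒≡ a j e
... | false with occurs⇒ j w h
... | x , e′ = Fin.suc x , e′

occurs-pivot-punchIn : ∀ {k n} (a : Fin (suc k)) (w : Vec (Fin k) n) → occurs a (map (punchIn a) w) ≡ false
occurs-pivot-punchIn a [] = refl
occurs-pivot-punchIn a (x ∷ w) rewrite punchIn-==-pivot a x = occurs-pivot-punchIn a w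

occurs-punchIn : ∀ {k n} (a : Fin (suc k)) j (w : Vec (Fin k) n) →
  occurs (punchIn a j) (map (punchIn a) w) ≡ occurs j w
occurs-punchIn a j [] = refl
occurs-punchIn a j (x ∷ w) rewrite ==-punchIn a x j | occurs-punchIn a j w = refl

sumVecs-avoid : ∀ k n (a : Fin (suc k)) (h : Vec (Fin (suc k)) n → ℤ) →
  sumVecs (suc k) n (λ v → 𝟙 (not (occurs a v)) * h v) ≡ sumVecs k n (λ v → h (map (punchIn a) v))
sumVecs-avoid k zero a h = ℤP.*-identityˡ (h [])
sumVecs-avoid k (suc n) a h = begin
  ∑[ c < suc k ] sumVecs (suc k) n (λ v → 𝟙 (not ((c == a) ∨ occurs a v)) * h (c ∷ v))
    ≡⟨ sum-cong-≗ (λ c → trans (sumVecs-cong (suc k) n (λ v → factor c v)) (sumVecs-* (suc k) n (𝟙 (not (c == a))) (λ v → 𝟙 (not (occurs a v)) * h (c ∷ v)))) ⟩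
  ∑[ c < suc k ] (𝟙 (not (c == a)) * sumVecs (suc k) n (λ v → 𝟙 (not (occurs a v)) * h (c ∷ v)))
    ≡⟨ sum-punchIn a (λ c → sumVecs (suc k) n (λ v → 𝟙 (not (occurs a v)) * h (c ∷ v))) ⟩
  ∑[ c < k ] sumVecs (suc k) n (λ v → 𝟙 (not (occurs a v)) * h (punchIn a c ∷ v))
    ≡⟨ sum-cong-≗ (λ c → sumVecs-avoid k n a (λ v → h (punchIn a c ∷ v))) ⟩
  ∑[ c < k ] sumVecs k n (λ v → h (punchIn a c ∷ map (punchIn a) v)) ∎
  where
  open ≡-Reasoning
  factor : ∀ c v → 𝟙 (not ((c == a) ∨ occurs a v)) * h (c ∷ v)
                   ≡ 𝟙 (not (c == a)) * (𝟙 (not (occurs a v)) * h (c ∷ v))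
  factor c v = trans (cong (_* h (c ∷ v)) (𝟙-not-∨ (c == a) (occurs a v)))
    (ℤP.*-assoc (𝟙 (not (c == a))) (𝟙 (not (occurs a v))) (h (c ∷ v)))

sameVec : ∀ {k n} → Vec (Fin k) n → Vec (Fin k) n → Bool
sameVec [] [] = true
sameVec (a ∷ v) (b ∷ v′) = (a == b) ∧ sameVec v v′

sameVec⇒ : ∀ {k n} (v v′ : Vec (Fin k) n) → sameVec v v′ ≡ true → ∀ x → lookup v x ≡ lookup v′ x
sameVec⇒ (a ∷ v) (b ∷ v′) h Fin.zero = ==⇒≡ a b (∧≡true⇒ˡ _ _ h)
sameVec⇒ (a ∷ v) (b ∷ v′) h (Fin.suc x) = sameVec⇒ v v′ (∧≡true⇒ʳ (a == b) _ h) x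

⇒sameVec : ∀ {k n} (v v′ : Vec (Fin k) n) → (∀ x → lookup v x ≡ lookup v′ x) → sameVec v v′ ≡ true
⇒sameVec [] [] h = refl
⇒sameVec (a ∷ v) (b ∷ v′) h rewrite h Fin.zero | ==-refl b = ⇒sameVec v v′ (λ x → h (Fin.suc x))

sumVecs-delta : ∀ k n (v₀ : Vec (Fin k) n) (G : Vec (Fin k) n → ℤ) →
  sumVecs k n (λ v → 𝟙 (sameVec v v₀) * G v) ≡ G v₀
sumVecs-delta k zero [] G = ℤP.*-identityˡ (G [])
sumVecs-delta k (suc n) (a₀ ∷ v₀) G = begin
  ∑[ a < k ] sumVecs k n (λ v → 𝟙 ((a == a₀) ∧ sameVec v v₀) * G (a ∷ v))
    ≡⟨ sum-cong-≗ (λ a → trans (sumVecs-cong k n (λ v → factor a v)) (sumVecs-* k n (𝟙 (a == a₀)) (λ v → 𝟙 (sameVec v v₀) * G (a ∷ v)))) ⟩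
  ∑[ a < k ] (𝟙 (a == a₀) * sumVecs k n (λ v → 𝟙 (sameVec v v₀) * G (a ∷ v)))
    ≡⟨ sum-cong-≗ (λ a → cong (𝟙 (a == a₀) *_) (sumVecs-delta k n v₀ (λ v → G (a ∷ v)))) ⟩
  ∑[ a < k ] (𝟙 (a == a₀) * G (a ∷ v₀))
    ≡⟨ sum-delta a₀ (λ a → G (a ∷ v₀)) ⟩
  G (a₀ ∷ v₀) ∎
  where
  open ≡-Reasoning
  factor : ∀ a v → 𝟙 ((a == a₀) ∧ sameVec v v₀) * G (a ∷ v) ≡ 𝟙 (a == a₀) * (𝟙 (sameVec v v₀) * G (a ∷ v))
  factor a v = trans (cong (_* G (a ∷ v)) (𝟙-∧ (a == a₀) (sameVec v v₀)))
    (ℤP.*-assoc (𝟙 (a == a₀)) (𝟙 (sameVec v v₀)) (G (a ∷ v)))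

sumℤ-++ : ∀ (xs ys : List ℤ) → sumℤ (xs ++ ys) ≡ sumℤ xs + sumℤ ys
sumℤ-++ [] ys = sym (ℤP.+-identityˡ _)
sumℤ-++ (x ∷ xs) ys = trans (cong (λ z → x + z) (sumℤ-++ xs ys)) (sym (ℤP.+-assoc x _ _))

sumℤ-concatMap : ∀ {A B : Set} (h : B → ℤ) (g : A → List B) (L : List A) →
  sumℤ (List.map h (concatMap g L)) ≡ sumℤ (List.map (λ a → sumℤ (List.map h (g a))) L)
sumℤ-concatMap h g [] = refl
sumℤ-concatMap h g (a ∷ L) = trans (cong sumℤ (LP.map-++ h (g a) (concatMap g L)))
  (trans (sumℤ-++ (List.map h (g a)) _) (cong (λ z → sumℤ (List.map h (g a)) + z) (sumℤ-concatMap h g L)))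

sumℤ-map-cong : ∀ {A : Set} (L : List A) {f g : A → ℤ} → (∀ x → f x ≡ g x) →
  sumℤ (List.map f L) ≡ sumℤ (List.map g L)
sumℤ-map-cong L e = cong sumℤ (LP.map-cong e L)

sumℤ-filter : ∀ {A : Set} (f : A → Bool) (P? : ∀ x → Dec (T (f x))) (h : A → ℤ) (L : List A) →
  sumℤ (List.map h (filter P? L)) ≡ sumℤ (List.map (λ x → 𝟙 (f x) * h x) L)
sumℤ-filter f P? h [] = refl
sumℤ-filter f P? h (x ∷ L) with P? x
... | yes t rewrite T⇒≡true t = cong₂ _+_ (sym (ℤP.*-identityˡ (h x))) (sumℤ-filter f P? h L)
... | no n rewrite ¬T⇒≡false n = trans (sumℤ-filter f P? h L) (sym (ℤP.+-identityˡ _))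

sumℤ-tabulate : ∀ {A : Set} k (g : A → ℤ) (f : Fin k → A) →
  sumℤ (List.map g (List.tabulate f)) ≡ ∑[ i < k ] g (f i)
sumℤ-tabulate zero g f = refl
sumℤ-tabulate (suc k) g f = cong (λ z → g (f Fin.zero) + z) (sumℤ-tabulate k g (λ i → f (Fin.suc i)))

sumℤ-applyUpTo : ∀ N (g : ℕ → ℤ) (f : ℕ → ℕ) →
  sumℤ (List.map g (applyUpTo f N)) ≡ ∑[ i < N ] g (f (toℕ i))
sumℤ-applyUpTo zero g f = refl
sumℤ-applyUpTo (suc N) g f = cong (λ z → g (f 0) + z) (sumℤ-applyUpTo N g (λ k → f (suc k)))

sumℤ-allVecs : ∀ k n (h : Vec (Fin k) n → ℤ) → sumℤ (List.map h (allVecs k n)) ≡ sumVecs k n h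
sumℤ-allVecs k zero h = ℤP.+-identityʳ (h [])
sumℤ-allVecs k (suc n) h = begin
  sumℤ (List.map h (concatMap (λ v → List.map (_∷ v) (List.allFin k)) (allVecs k n)))
    ≡⟨ sumℤ-concatMap h (λ v → List.map (_∷ v) (List.allFin k)) (allVecs k n) ⟩
  sumℤ (List.map (λ v → sumℤ (List.map h (List.map (_∷ v) (List.allFin k)))) (allVecs k n))
    ≡⟨ sumℤ-map-cong (allVecs k n) (λ v → trans (cong sumℤ (sym (LP.map-∘ (List.allFin k))))
                                               (sumℤ-tabulate k (λ a → h (a ∷ v)) (λ i → i))) ⟩
  sumℤ (List.map (λ v → ∑[ a < k ] h (a ∷ v)) (allVecs k n))
    ≡⟨ sumℤ-allVecs k n (λ v → ∑[ a < k ] h (a ∷ v)) ⟩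
  sumVecs k n (λ v → ∑[ a < k ] h (a ∷ v))
    ≡⟨ sum-sumVecs-comm k k n (λ a v → h (a ∷ v)) ⟨
  sumVecs k (suc n) h ∎
  where open ≡-Reasoning

all-tabulate : ∀ {A : Set} k (p : A → Bool) (f : Fin k → A) → all p (List.tabulate f) ≡ allᶠ k (λ i → p (f i))
all-tabulate zero p f = refl
all-tabulate (suc k) p f = cong (p (f Fin.zero) ∧_) (all-tabulate k p (λ i → f (Fin.suc i)))

any-tabulate : ∀ {A : Set} k (p : A → Bool) (f : Fin k → A) → any p (List.tabulate f) ≡ anyᶠ k (λ i → p (f i))
any-tabulate zero p f = refl
any-tabulate (suc k) p f = cong (p (f Fin.zero) ∨_) (any-tabulate k p (λ i → f (Fin.suc i)))

all-allFin : ∀ k (p : Fin k → Bool) → all p (List.allFin k) ≡ allᶠ k p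
all-allFin k p = all-tabulate k p (λ i → i)

any-allFin : ∀ k (p : Fin k → Bool) → any p (List.allFin k) ≡ anyᶠ k p
any-allFin k p = any-tabulate k p (λ i → i)

countᶠ : (k : ℕ) → (Fin k → Bool) → ℕ
countᶠ zero h = 0
countᶠ (suc k) h = if h Fin.zero then suc (countᶠ k (λ i → h (Fin.suc i))) else countᶠ k (λ i → h (Fin.suc i))

length-filter-allFin : ∀ k (g : Fin k → Bool) (P? : ∀ x → Dec (T (g x))) →
  List.length (filter P? (List.allFin k)) ≡ countᶠ k g
length-filter-allFin k g P? = go k (λ i → i)
  where
  go : ∀ k′ (f : Fin k′ → Fin k) → List.length (filter P? (List.tabulate f)) ≡ countᶠ k′ (λ i → g (f i))
  go zero f = refl
  go (suc k′) f with P? (f Fin.zero)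
  ... | yes t rewrite T⇒≡true t = cong suc (go k′ (λ i → f (Fin.suc i)))
  ... | no n rewrite ¬T⇒≡false n = go k′ (λ i → f (Fin.suc i))

any-concatMap : ∀ {A B : Set} (f : B → Bool) (g : A → List B) (L : List A) →
  any f (concatMap g L) ≡ any (λ a → any f (g a)) L
any-concatMap f g [] = refl
any-concatMap f g (a ∷ L) = trans (any-++ (g a) (concatMap g L)) (cong (any f (g a) ∨_) (any-concatMap f g L))
  where
  any-++ : ∀ xs ys → any f (xs ++ ys) ≡ any f xs ∨ any f ys
  any-++ [] ys = refl
  any-++ (x ∷ xs) ys = trans (cong (f x ∨_) (any-++ xs ys)) (sym (BP.∨-assoc (f x) _ _))

any-allVecs-suc : ∀ k n (f : Vec (Fin k) (suc n) → Bool) →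
  any f (allVecs k (suc n)) ≡ any (λ v → anyᶠ k (λ a → f (a ∷ v))) (allVecs k n)
any-allVecs-suc k n f = trans (any-concatMap f (λ v → List.map (_∷ v) (List.allFin k)) (allVecs k n))
  (cong or (LP.map-cong (λ v → trans (cong or (sym (LP.map-∘ (List.allFin k)))) (any-allFin k (λ a → f (a ∷ v))))
                        (allVecs k n)))

-- Block sequences

-- (ψ-label, size is odd)
Block : Set
Block = ℕ × Bool

canPrecede : Block → ℕ → Bool
canPrecede (c , o) d = (c ≤ᵇ d) ∧ (o ∨ (c ≡ᵇ d))

-- The end of the list acts as a successor that only an odd block may precede.
canPrecedeHead : ∀ {n} → Block → Vec Block n → Bool
canPrecedeHead x [] = proj₂ x
canPrecedeHead x (z ∷ r) = canPrecede x (proj₁ z)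

admissible : ∀ {n} → Vec Block n → Bool
admissible [] = true
admissible (x ∷ r) = canPrecedeHead x r ∧ admissible r

flipParity : Block → Block
flipParity (c , o) = (c , not o)

flipAt : ∀ {n} → Fin n → Vec Block n → Vec Block n
flipAt Fin.zero (x ∷ r) = flipParity x ∷ r
flipAt (Fin.suc a) (x ∷ r) = x ∷ flipAt a r

insertAt : ∀ {n} → Fin (suc n) → Block → Vec Block n → Vec Block (suc n)
insertAt Fin.zero y r = y ∷ r
insertAt (Fin.suc a) y (x ∷ r) = x ∷ insertAt a y r

hasLabel : ∀ {n} → ℕ → Vec Block n → Bool
hasLabel b [] = false
hasLabel b (x ∷ r) = (proj₁ x ≡ᵇ b) ∨ hasLabel b r

flipCount : ∀ {n} → ℕ → Vec Block n → ℤ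
flipCount {n} b L = ∑[ a < n ] 𝟙 ((proj₁ (lookup L a) ≡ᵇ b) ∧ admissible (flipAt a L))

insertCount : ∀ {n} → ℕ → Vec Block n → ℤ
insertCount {n} b L = ∑[ a < suc n ] 𝟙 (admissible (insertAt a (b , true) L))

-- The effect of prepending (c , o) to a sequence with head label d, proved by
-- a finite case analysis on the relative order of b, c and d.
InsertFlipLocal : ℕ → Bool → ℕ → ℕ → Bool → Bool → Set
InsertFlipLocal c o b d R M =
  let x = (c , o) ; y = (b , true) in
  𝟙 (canPrecede y c ∧ (canPrecede x d ∧ R)) + 𝟙 (canPrecede x b ∧ (canPrecede y d ∧ R))
    + 𝟙 (canPrecede x d) * ((1ℤ + 𝟙 M) * 𝟙 R) - 𝟙 (canPrecede x d) * 𝟙 (canPrecede y d ∧ R)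
  ≡ 𝟙 ((c ≡ᵇ b) ∧ (canPrecede (flipParity x) d ∧ R)) + (1ℤ + 𝟙 ((c ≡ᵇ b) ∨ M)) * 𝟙 (canPrecede x d ∧ R)

insertFlip-local-<≤ : ∀ {c b d} o R M → c < b → b ≤ d → InsertFlipLocal c o b d R M
insertFlip-local-<≤ o R M c<b b≤d
  rewrite ≤⇒≤ᵇ≡true (ℕP.<⇒≤ c<b) | >⇒≤ᵇ≡false c<b | ≢⇒≡ᵇ≡false (ℕP.<⇒≢ c<b)
        | ≤⇒≤ᵇ≡true b≤d | ≤⇒≤ᵇ≡true (ℕP.<⇒≤ (ℕP.<-≤-trans c<b b≤d)) | ≢⇒≡ᵇ≡false (ℕP.<⇒≢ (ℕP.<-≤-trans c<b b≤d))
  with o | R | M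
... | true | true | true = refl
... | true | true | false = refl
... | true | false | true = refl
... | true | false | false = refl
... | false | true | true = refl
... | false | true | false = refl
... | false | false | true = refl
... | false | false | false = refl

insertFlip-local-<> : ∀ {c b d} o R M → c < b → d < b → InsertFlipLocal c o b d R M
insertFlip-local-<> {c} {b} {d} o R M c<b d<b
  rewrite ≤⇒≤ᵇ≡true (ℕP.<⇒≤ c<b) | >⇒≤ᵇ≡false c<b | ≢⇒≡ᵇ≡false (ℕP.<⇒≢ c<b) | >⇒≤ᵇ≡false d<b
  with c ≤ᵇ d | o | c ≡ᵇ d | R | M
... | true | true | true | true | true = refl
... | true | true | true | true | false = refl
... | true | true | true | false | true = refl
... | true | true | true | false | false = refl
... | true | true | false | true | true = refl
... | true | true | false | true | false = refl
... | true | true | false | false | true = refl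
... | true | true | false | false | false = refl
... | true | false | true | true | true = refl
... | true | false | true | true | false = refl
... | true | false | true | false | true = refl
... | true | false | true | false | false = refl
... | true | false | false | true | true = refl
... | true | false | false | true | false = refl
... | true | false | false | false | true = refl
... | true | false | false | false | false = refl
... | false | true | true | true | true = refl
... | false | true | true | true | false = refl
... | false | true | true | false | true = refl
... | false | true | true | false | false = refl
... | false | true | false | true | true = refl
... | false | true | false | true | false = refl
... | false | true | false | false | true = refl
... | false | true | false | false | false = refl
... | false | false | true | true | true = refl
... | false | false | true | true | false = refl
... | false | false | true | false | true = refl
... | false | false | true | false | false = refl
... | false | false | false | true | true = refl
... | false | false | false | true | false = refl
... | false | false | false | false | true = refl
... | false | false | false | false | false = refl

insertFlip-local-≡ : ∀ {c d} o R M → (R ≡ true → c < d → M ≡ false) → (d ≡ c → M ≡ true) →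
  InsertFlipLocal c o c d R M
insertFlip-local-≡ {c} {d} o R M absent present rewrite ≤⇒≤ᵇ≡true (ℕP.≤-refl {c}) | ≡ᵇ-refl c with ℕP.<-cmp d c
... | tri< d<c _ _ rewrite >⇒≤ᵇ≡false d<c with o | R | M
... | true | true | true = refl
... | true | true | false = refl
... | true | false | true = refl
... | true | false | false = refl
... | false | true | true = refl
... | false | true | false = refl
... | false | false | true = refl
... | false | false | false = refl
insertFlip-local-≡ {c} {d} o R M absent present | tri≈ _ refl _ rewrite ≤⇒≤ᵇ≡true (ℕP.≤-refl {d}) | ≡ᵇ-refl d | present refl with o | R
... | true | true = refl
... | true | false = refl
... | false | true = refl
... | false | false = refl
insertFlip-local-≡ {c} {d} o R M absent present | tri> _ _ c<d
  rewrite ≤⇒≤ᵇ≡true (ℕP.<⇒≤ c<d) | ≢⇒≡ᵇ≡false (ℕP.<⇒≢ c<d) with o | R | M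
... | true | true | true = ⊥-elim (true≢false (absent refl c<d))
... | true | true | false = refl
... | true | false | true = refl
... | true | false | false = refl
... | false | true | true = refl
... | false | true | false = refl
... | false | false | true = refl
... | false | false | false = refl

insertFlip-local-> : ∀ {c b d} o R M → b < c → InsertFlipLocal c o b d R M
insertFlip-local-> {c} {b} {d} o R M b<c
  rewrite >⇒≤ᵇ≡false b<c | ≤⇒≤ᵇ≡true (ℕP.<⇒≤ b<c) | ≢⇒≡ᵇ≡false (ℕP.>⇒≢ b<c) with c ℕ.≤? d
... | no c≰d rewrite >⇒≤ᵇ≡false (ℕP.≰⇒> c≰d) with o | R | M
... | true | true | true = refl
... | true | true | false = refl
... | true | false | true = refl
... | true | false | false = refl
... | false | true | true = refl
... | false | true | false = refl
... | false | false | true = refl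
... | false | false | false = refl
insertFlip-local-> {c} {b} {d} o R M b<c | yes c≤d
  rewrite ≤⇒≤ᵇ≡true c≤d | ≤⇒≤ᵇ≡true (ℕP.≤-trans (ℕP.<⇒≤ b<c) c≤d) with o | c ≡ᵇ d | R | M
... | true | true | true | true = refl
... | true | true | true | false = refl
... | true | true | false | true = refl
... | true | true | false | false = refl
... | true | false | true | true = refl
... | true | false | true | false = refl
... | true | false | false | true = refl
... | true | false | false | false = refl
... | false | true | true | true = refl
... | false | true | true | false = refl
... | false | true | false | true = refl
... | false | true | false | false = refl
... | false | false | true | true = refl
... | false | false | true | false = refl
... | false | false | false | true = refl
... | false | false | false | false = refl

insertFlip-local : ∀ c o b d R M → (R ≡ true → b < d → M ≡ false) → (d ≡ b → M ≡ true) →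
  InsertFlipLocal c o b d R M
insertFlip-local c o b d R M absent present with ℕP.<-cmp c b | b ℕ.≤? d
... | tri< c<b _ _ | yes b≤d = insertFlip-local-<≤ o R M c<b b≤d
... | tri< c<b _ _ | no b≰d = insertFlip-local-<> o R M c<b (ℕP.≰⇒> b≰d)
... | tri≈ _ refl _ | _ = insertFlip-local-≡ o R M absent present
... | tri> _ _ b<c | _ = insertFlip-local-> o R M b<c

insertFlip-singleton : ∀ c o b →
  let x = (c , o) ; y = (b , true) in
  𝟙 (canPrecede y c ∧ (o ∧ true)) + (𝟙 (canPrecede x b ∧ (true ∧ true)) + 0ℤ)
  ≡ (𝟙 ((c ≡ᵇ b) ∧ (not o ∧ true)) + 0ℤ) + (1ℤ + 𝟙 ((c ≡ᵇ b) ∨ false)) * 𝟙 (o ∧ true)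
insertFlip-singleton c o b with ℕP.<-cmp c b
... | tri< c<b _ _ rewrite ≤⇒≤ᵇ≡true (ℕP.<⇒≤ c<b) | >⇒≤ᵇ≡false c<b | ≢⇒≡ᵇ≡false (ℕP.<⇒≢ c<b) with o
... | true = refl
... | false = refl
insertFlip-singleton c o b | tri≈ _ refl _ rewrite ≤⇒≤ᵇ≡true (ℕP.≤-refl {c}) | ≡ᵇ-refl c with o
... | true = refl
... | false = refl
insertFlip-singleton c o b | tri> _ _ b<c rewrite >⇒≤ᵇ≡false b<c | ≤⇒≤ᵇ≡true (ℕP.<⇒≤ b<c) | ≢⇒≡ᵇ≡false (ℕP.>⇒≢ b<c) with o
... | true = refl
... | false = refl

hasLabel-below-head : ∀ {n} b (z : Block) (r : Vec Block n) →
  admissible (z ∷ r) ≡ true → b < proj₁ z → hasLabel b (z ∷ r) ≡ false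
hasLabel-below-head b (d , o) [] v b<d rewrite ≢⇒≡ᵇ≡false (ℕP.>⇒≢ b<d) = refl
hasLabel-below-head b (d , o) ((d′ , o′) ∷ r) v b<d with d ≤ᵇ d′ in e | admissible ((d′ , o′) ∷ r) in rest
... | true | true rewrite ≢⇒≡ᵇ≡false (ℕP.>⇒≢ b<d) =
  hasLabel-below-head b (d′ , o′) r rest (ℕP.<-≤-trans b<d (≤ᵇ≡true⇒≤ e))
... | true | false = ⊥-elim (true≢false (trans (sym v) (BP.∧-zeroʳ _)))
... | false | _ = ⊥-elim (true≢false (sym v))

canPrecedeHead-flipAt : ∀ {n} x (z : Block) (r : Vec Block n) (a : Fin (suc n)) →
  canPrecedeHead x (flipAt a (z ∷ r)) ≡ canPrecede x (proj₁ z)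
canPrecedeHead-flipAt x z r Fin.zero = refl
canPrecedeHead-flipAt x z r (Fin.suc a) = refl

insertCount-flipCount : ∀ {n} b (L : Vec Block n) →
  insertCount b L ≡ flipCount b L + (1ℤ + 𝟙 (hasLabel b L)) * 𝟙 (admissible L)
insertCount-flipCount b [] = refl
insertCount-flipCount b ((c , o) ∷ []) = insertFlip-singleton c o b
insertCount-flipCount {suc (suc n)} b ((c , o) ∷ z ∷ r) =
  trans insertCount-cons (trans (glue (insertCount-flipCount b (z ∷ r)) (insertFlip-local c o b d R M (hasLabel-below-head b z r) present)) (cong (_+ K) (sym flipCount-cons)))
  where
  x y : Block
  x = (c , o)
  y = (b , true)
  d : ℕ
  d = proj₁ z
  R M : Bool
  R = admissible (z ∷ r)
  M = hasLabel b (z ∷ r)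
  Λ α β γ F₀ K : ℤ
  Λ = 𝟙 (canPrecede x d)
  α = 𝟙 (canPrecede y c ∧ (canPrecede x d ∧ R))
  β = 𝟙 (canPrecede x b ∧ (canPrecede y d ∧ R))
  γ = 𝟙 (canPrecede y d ∧ R)
  F₀ = 𝟙 ((c ≡ᵇ b) ∧ (canPrecede (flipParity x) d ∧ R))
  K = (1ℤ + 𝟙 ((c ≡ᵇ b) ∨ M)) * 𝟙 (canPrecede x d ∧ R)
  insertBehind : ℤ
  insertBehind = ∑[ a < suc n ] 𝟙 (admissible (z ∷ insertAt a y r))
  present : d ≡ b → M ≡ true
  present refl = cong (_∨ hasLabel d r) (≡ᵇ-refl d)
  insertCount-cons : insertCount b (x ∷ z ∷ r)
    ≡ α + (β + Λ * insertBehind)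
  insertCount-cons = cong (λ t → α + (β + t))
    (trans (sum-cong-≗ (λ a → 𝟙-∧ (canPrecede x d) (admissible (z ∷ insertAt a y r))))
           (sym (*-distribˡ-sum Λ (λ a → 𝟙 (admissible (z ∷ insertAt a y r))))))
  flipCount-cons : flipCount b (x ∷ z ∷ r) ≡ F₀ + Λ * flipCount b (z ∷ r)
  flipCount-cons = cong (λ t → F₀ + t)
    (trans (sum-cong-≗ (λ a → trans (cong (λ q → 𝟙 ((proj₁ (lookup (z ∷ r) a) ≡ᵇ b) ∧ (q ∧ admissible (flipAt a (z ∷ r)))))
                                           (canPrecedeHead-flipAt x z r a))
                                     (𝟙-∧-middle (proj₁ (lookup (z ∷ r) a) ≡ᵇ b) (canPrecede x d) (admissible (flipAt a (z ∷ r))))))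
           (sym (*-distribˡ-sum Λ (λ a → 𝟙 ((proj₁ (lookup (z ∷ r) a) ≡ᵇ b) ∧ admissible (flipAt a (z ∷ r)))))))
  glue : ∀ {T Fr P} → γ + T ≡ Fr + P → α + β + Λ * P - Λ * γ ≡ F₀ + K → α + (β + Λ * T) ≡ (F₀ + Λ * Fr) + K
  glue {T} {Fr} {P} h₁ h₂ = begin
    α + (β + Λ * T)                    ≡⟨ cong (λ t → α + (β + Λ * t)) (trans (cancel γ T) (cong (_- γ) h₁)) ⟩
    α + (β + Λ * ((Fr + P) - γ))       ≡⟨ regroup α β Λ Fr P γ ⟩
    (α + β + Λ * P - Λ * γ) + Λ * Fr   ≡⟨ cong (_+ Λ * Fr) h₂ ⟩
    (F₀ + K) + Λ * Fr                  ≡⟨ swapʳ F₀ K (Λ * Fr) ⟩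
    (F₀ + Λ * Fr) + K                  ∎
    where
    open ≡-Reasoning
    cancel : ∀ g t → t ≡ (g + t) - g
    cancel = solve-∀
    regroup : ∀ a b l f p g → a + (b + l * ((f + p) - g)) ≡ (a + b + l * p - l * g) + l * f
    regroup = solve-∀
    swapʳ : ∀ a b c → (a + b) + c ≡ (a + c) + b
    swapʳ = solve-∀

-- Labelled maps Fin p → Fin ℓ

fibreSize : ∀ {ℓ p} → Vec (Fin ℓ) p → Fin ℓ → ℕ
fibreSize [] j = 0
fibreSize (a ∷ w) j = if a == j then suc (fibreSize w j) else fibreSize w j

fibreLabel : ∀ {ℓ p} → Vec ℕ p → Vec (Fin ℓ) p → Fin ℓ → ℕ
fibreLabel [] [] j = 0
fibreLabel (b ∷ u) (a ∷ w) j = if a == j then b else fibreLabel u w j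

isOdd-+2 : ∀ m → isOdd (suc (suc m)) ≡ isOdd m
isOdd-+2 m = cong (_≡ᵇ 1) (trans (cong (ℕ._% 2) (ℕP.+-comm 2 m)) (DM.[m+n]%n≡m%n m 2))

isOdd-suc : ∀ m → isOdd (suc m) ≡ not (isOdd m)
isOdd-suc zero = refl
isOdd-suc (suc zero) = refl
isOdd-suc (suc (suc m)) = trans (isOdd-+2 (suc m)) (trans (isOdd-suc m) (cong not (sym (isOdd-+2 m))))

blockOf : ∀ {ℓ p} → Vec ℕ p → Vec (Fin ℓ) p → Fin ℓ → Block
blockOf u w j = (fibreLabel u w j , isOdd (fibreSize w j))

blocksOf : ∀ {ℓ p} → Vec ℕ p → Vec (Fin ℓ) p → Vec Block ℓ
blocksOf u w = tabulate (blockOf u w)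

constantOnFibres : ∀ {ℓ p} → Vec ℕ p → Vec (Fin ℓ) p → Bool
constantOnFibres [] [] = true
constantOnFibres (b ∷ u) (a ∷ w) = (not (occurs a w) ∨ (fibreLabel u w a ≡ᵇ b)) ∧ constantOnFibres u w

onto : ∀ {ℓ p} → Vec (Fin ℓ) p → Bool
onto {ℓ} w = allᶠ ℓ (λ j → occurs j w)

Valid : ∀ {ℓ p} → Vec ℕ p → Vec (Fin ℓ) p → Bool
Valid u w = constantOnFibres u w ∧ admissible (blocksOf u w)

occursℕ : ∀ {p} → ℕ → Vec ℕ p → Bool
occursℕ b [] = false
occursℕ b (c ∷ u) = (c ≡ᵇ b) ∨ occursℕ b u

repeats : ∀ {p} → Vec ℕ p → ℕ
repeats [] = 0
repeats (b ∷ u) = if occursℕ b u then suc (repeats u) else repeats u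

fibreSize-pivot-punchIn : ∀ {k p} (a : Fin (suc k)) (w : Vec (Fin k) p) → fibreSize (map (punchIn a) w) a ≡ 0
fibreSize-pivot-punchIn a [] = refl
fibreSize-pivot-punchIn a (x ∷ w) rewrite punchIn-==-pivot a x = fibreSize-pivot-punchIn a w

fibreSize-punchIn : ∀ {k p} (a : Fin (suc k)) j (w : Vec (Fin k) p) →
  fibreSize (map (punchIn a) w) (punchIn a j) ≡ fibreSize w j
fibreSize-punchIn a j [] = refl
fibreSize-punchIn a j (x ∷ w) rewrite ==-punchIn a x j | fibreSize-punchIn a j w = refl

fibreLabel-punchIn : ∀ {k p} (a : Fin (suc k)) j (u : Vec ℕ p) (w : Vec (Fin k) p) →
  fibreLabel u (map (punchIn a) w) (punchIn a j) ≡ fibreLabel u w j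
fibreLabel-punchIn a j [] [] = refl
fibreLabel-punchIn a j (b ∷ u) (x ∷ w) rewrite ==-punchIn a x j | fibreLabel-punchIn a j u w = refl

constantOnFibres-punchIn : ∀ {k p} (a : Fin (suc k)) (u : Vec ℕ p) (w : Vec (Fin k) p) →
  constantOnFibres u (map (punchIn a) w) ≡ constantOnFibres u w
constantOnFibres-punchIn a [] [] = refl
constantOnFibres-punchIn a (b ∷ u) (x ∷ w) rewrite occurs-punchIn a x w | fibreLabel-punchIn a x u w | constantOnFibres-punchIn a u w = refl

onto-pivot-punchIn : ∀ {k p} (a : Fin (suc k)) (w : Vec (Fin k) p) → onto (a ∷ map (punchIn a) w) ≡ onto w
onto-pivot-punchIn {k} a w = trans (allᶠ-punchIn k a (λ j → occurs j (a ∷ map (punchIn a) w)))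
  (trans (cong (λ z → (z ∨ occurs a (map (punchIn a) w)) ∧ allᶠ k (λ j → occurs (punchIn a j) (a ∷ map (punchIn a) w))) (==-refl a))
         (allᶠ-cong k (λ j → trans (cong (_∨ occurs (punchIn a j) (map (punchIn a) w)) (pivot-==-punchIn a j)) (occurs-punchIn a j w))))

onto-occurs : ∀ {k p} (a : Fin k) (w : Vec (Fin k) p) → occurs a w ≡ true → onto (a ∷ w) ≡ onto w
onto-occurs {k} a w h = allᶠ-cong k absorb
  where
  absorb : ∀ j → ((a == j) ∨ occurs j w) ≡ occurs j w
  absorb j with a == j in e
  ... | true rewrite ==⇒≡ a j e = sym h
  ... | false = refl

onto-missing : ∀ {k p} (a : Fin k) (w : Vec (Fin k) p) → occurs a w ≡ false → onto w ≡ false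
onto-missing {k} a w h with onto w in e
... | false = refl
... | true = ⊥-elim (true≢false (trans (sym (allᶠ⇒ k _ e a)) h))

𝟙-onto-split : ∀ {k p} (a : Fin k) (w : Vec (Fin k) p) V →
  𝟙 (onto (a ∷ w) ∧ V) ≡ 𝟙 (onto w ∧ V) + 𝟙 (not (occurs a w)) * 𝟙 (onto (a ∷ w) ∧ V)
𝟙-onto-split a w V with occurs a w in e
... | true rewrite onto-occurs a w e = sym (ℤP.+-identityʳ _)
... | false rewrite onto-missing a w e = sym (trans (ℤP.+-identityˡ _) (ℤP.*-identityˡ _))

tabulate-flipAt : ∀ {n} (f g : Fin n → Block) a → g a ≡ flipParity (f a) → (∀ j → (a == j) ≡ false → g j ≡ f j) →
  tabulate g ≡ flipAt a (tabulate f)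
tabulate-flipAt f g Fin.zero h₁ h₂ = cong₂ _∷_ h₁ (VP.tabulate-cong (λ j → h₂ (Fin.suc j) refl))
tabulate-flipAt f g (Fin.suc a) h₁ h₂ = cong₂ _∷_ (h₂ Fin.zero refl)
  (tabulate-flipAt (λ j → f (Fin.suc j)) (λ j → g (Fin.suc j)) a h₁ (λ j e → h₂ (Fin.suc j) e))

tabulate-insertAt : ∀ {n} (f : Fin n → Block) (g : Fin (suc n) → Block) a y →
  g a ≡ y → (∀ j → g (punchIn a j) ≡ f j) → tabulate g ≡ insertAt a y (tabulate f)
tabulate-insertAt f g Fin.zero y h₁ h₂ = cong₂ _∷_ h₁ (VP.tabulate-cong h₂)
tabulate-insertAt {suc n} f g (Fin.suc a) y h₁ h₂ = cong₂ _∷_ (h₂ Fin.zero)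
  (tabulate-insertAt (λ j → f (Fin.suc j)) (λ j → g (Fin.suc j)) a y h₁ (λ j → h₂ (Fin.suc j)))

blocksOf-flip : ∀ {k p} b (u : Vec ℕ p) (a : Fin k) (w : Vec (Fin k) p) → fibreLabel u w a ≡ b →
  blocksOf (b ∷ u) (a ∷ w) ≡ flipAt a (blocksOf u w)
blocksOf-flip b u a w h = tabulate-flipAt (blockOf u w) (blockOf (b ∷ u) (a ∷ w)) a atPivot elsewhere
  where
  atPivot : blockOf (b ∷ u) (a ∷ w) a ≡ flipParity (blockOf u w a)
  atPivot rewrite ==-refl a | h | isOdd-suc (fibreSize w a) = refl
  elsewhere : ∀ j → (a == j) ≡ false → blockOf (b ∷ u) (a ∷ w) j ≡ blockOf u w j
  elsewhere j e rewrite e = refl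

blocksOf-insert : ∀ {k p} b (u : Vec ℕ p) (a : Fin (suc k)) (w : Vec (Fin k) p) →
  blocksOf (b ∷ u) (a ∷ map (punchIn a) w) ≡ insertAt a (b , true) (blocksOf u w)
blocksOf-insert b u a w = tabulate-insertAt (blockOf u w) (blockOf (b ∷ u) (a ∷ map (punchIn a) w)) a (b , true) atPivot elsewhere
  where
  atPivot : blockOf (b ∷ u) (a ∷ map (punchIn a) w) a ≡ (b , true)
  atPivot rewrite ==-refl a | fibreSize-pivot-punchIn a w = refl
  elsewhere : ∀ j → blockOf (b ∷ u) (a ∷ map (punchIn a) w) (punchIn a j) ≡ blockOf u w j
  elsewhere j rewrite pivot-==-punchIn a j | fibreLabel-punchIn a j u w | fibreSize-punchIn a j w = refl

occursℕ⇒ : ∀ {p} b (u : Vec ℕ p) → occursℕ b u ≡ true → ∃ λ x → lookup u x ≡ b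
occursℕ⇒ b (c ∷ u) h with c ≡ᵇ b in e
... | true = Fin.zero , ≡ᵇ≡true⇒≡ e
... | false with occursℕ⇒ b u h
... | x , e′ = Fin.suc x , e′

⇒occursℕ : ∀ {p} b (u : Vec ℕ p) x → lookup u x ≡ b → occursℕ b u ≡ true
⇒occursℕ b (c ∷ u) Fin.zero refl rewrite ≡ᵇ-refl c = refl
⇒occursℕ b (c ∷ u) (Fin.suc x) h with c ≡ᵇ b
... | true = refl
... | false = ⇒occursℕ b u x h

hasLabel-tabulate : ∀ {k} b (f : Fin k → Block) → hasLabel b (tabulate f) ≡ anyᶠ k (λ j → proj₁ (f j) ≡ᵇ b)
hasLabel-tabulate {zero} b f = refl
hasLabel-tabulate {suc k} b f = cong ((proj₁ (f Fin.zero) ≡ᵇ b) ∨_) (hasLabel-tabulate b (λ j → f (Fin.suc j)))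

fibreLabel-lookup : ∀ {k p} (u : Vec ℕ p) (w : Vec (Fin k) p) → constantOnFibres u w ≡ true →
  ∀ x → fibreLabel u w (lookup w x) ≡ lookup u x
fibreLabel-lookup (b ∷ u) (a ∷ w) h Fin.zero rewrite ==-refl a = refl
fibreLabel-lookup (b ∷ u) (a ∷ w) h (Fin.suc x) with a == lookup w x in e
... | false = fibreLabel-lookup u w (∧≡true⇒ʳ _ _ h) x
... | true rewrite ==⇒≡ a (lookup w x) e | occurs-lookup w x =
  trans (sym (≡ᵇ≡true⇒≡ (∧≡true⇒ˡ _ _ h))) (fibreLabel-lookup u w (∧≡true⇒ʳ _ _ h) x)

hasLabel-blocksOf : ∀ {k p} b (u : Vec ℕ p) (w : Vec (Fin k) p) → constantOnFibres u w ≡ true → onto w ≡ true →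
  hasLabel b (blocksOf u w) ≡ occursℕ b u
hasLabel-blocksOf {k} b u w agree hs = trans (hasLabel-tabulate b (blockOf u w)) (true-iff⇒≡ _ _ to from)
  where
  to : anyᶠ k (λ j → fibreLabel u w j ≡ᵇ b) ≡ true → occursℕ b u ≡ true
  to h with anyᶠ⇒ k _ h
  ... | j , e with occurs⇒ j w (allᶠ⇒ k _ hs j)
  ... | x , refl = ⇒occursℕ b u x (trans (sym (fibreLabel-lookup u w agree x)) (≡ᵇ≡true⇒≡ e))
  from : occursℕ b u ≡ true → anyᶠ k (λ j → fibreLabel u w j ≡ᵇ b) ≡ true
  from h with occursℕ⇒ b u h
  ... | x , refl = ⇒anyᶠ k _ (lookup w x) (subst (λ z → (z ≡ᵇ lookup u x) ≡ true)
                                             (sym (fibreLabel-lookup u w agree x)) (≡ᵇ-refl (lookup u x)))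

section⇒≤ : ∀ {k p} (s : Fin k → Fin p) (f : Fin p → Fin k) → (∀ j → f (s j) ≡ j) → k ≤ p
section⇒≤ s f fs = FP.injective⇒≤ (λ {i} {j} e → trans (sym (fs i)) (trans (cong f e) (fs j)))

onto⇒≤ : ∀ {k p} (w : Vec (Fin k) p) → onto w ≡ true → k ≤ p
onto⇒≤ {k} w hs = section⇒≤ (λ j → proj₁ (hit j)) (lookup w) (λ j → proj₂ (hit j))
  where
  hit : ∀ j → ∃ λ x → lookup w x ≡ j
  hit j = occurs⇒ j w (allᶠ⇒ k _ hs j)

-- The signed count of valid maps

validCount : ∀ {p} → ℕ → Vec ℕ p → ℤ
validCount {p} ℓ u = sumVecs ℓ p (λ w → 𝟙 (onto w ∧ Valid u w))

signedValidCount : ∀ {p} → ℕ → Vec ℕ p → ℤ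
signedValidCount N u = ∑[ ℓ < N ] (-1ℤ ^ toℕ ℓ * validCount (toℕ ℓ) u)

sum-last : ∀ N (f : ℕ → ℤ) → ∑[ i < suc N ] f (toℕ i) ≡ ∑[ i < N ] f (toℕ i) + f N
sum-last N f = trans (sum-init-last {n = N} (λ i → f (toℕ i)))
  (cong₂ _+_ (sum-cong-≗ {n = N} (λ i → cong f (FP.toℕ-inject₁ i))) (cong f (FP.toℕ-fromℕ N)))

sumVecs-onto-vanish : ∀ {p} k (f : Vec (Fin k) p → ℤ) → p < k → sumVecs k p (λ w → 𝟙 (onto w) * f w) ≡ 0ℤ
sumVecs-onto-vanish {p} k f p<k = trans (sumVecs-cong k p term) (sumVecs-zero k p)
  where
  term : ∀ w → 𝟙 (onto w) * f w ≡ 0ℤ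
  term w with onto w in e
  ... | false = refl
  ... | true = ⊥-elim (ℕP.<⇒≱ p<k (onto⇒≤ w e))

-- A new point labelled b either joins an existing block a of w, or forms a
-- new singleton block at position a.
module AddPoint {p : ℕ} (b : ℕ) (u : Vec ℕ p) where

  joinCount : ∀ {k} → Vec (Fin k) p → ℤ
  joinCount {k} w = ∑[ a < k ] 𝟙 (Valid (b ∷ u) (a ∷ w))

  newBlockCount : ∀ {k} → Vec (Fin k) p → ℤ
  newBlockCount {k} w = ∑[ a < suc k ] 𝟙 (Valid (b ∷ u) (a ∷ map (punchIn a) w))

  joinCount-flipCount : ∀ {k} (w : Vec (Fin k) p) → onto w ≡ true →
    joinCount w ≡ 𝟙 (constantOnFibres u w) * flipCount b (blocksOf u w)
  joinCount-flipCount {k} w hs = trans (sum-cong-≗ term) (sym (*-distribˡ-sum (𝟙 (constantOnFibres u w)) flipTerm))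
    where
    flipTerm : Fin k → ℤ
    flipTerm a = 𝟙 ((proj₁ (lookup (blocksOf u w) a) ≡ᵇ b) ∧ admissible (flipAt a (blocksOf u w)))
    split : ∀ E c (s₁ s₂ : Vec Block k) → (E ≡ true → s₁ ≡ s₂) → 𝟙 ((E ∧ c) ∧ admissible s₁) ≡ 𝟙 c * 𝟙 (E ∧ admissible s₂)
    split false c s₁ s₂ h = sym (ℤP.*-zeroʳ (𝟙 c))
    split true c s₁ s₂ h rewrite h refl = 𝟙-∧ c (admissible s₂)
    term : ∀ a → 𝟙 (Valid (b ∷ u) (a ∷ w)) ≡ 𝟙 (constantOnFibres u w) * flipTerm a
    term a rewrite allᶠ⇒ k _ hs a | VP.lookup∘tabulate (blockOf u w) a =
      split (fibreLabel u w a ≡ᵇ b) (constantOnFibres u w) (blocksOf (b ∷ u) (a ∷ w)) (flipAt a (blocksOf u w))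
            (λ e → blocksOf-flip b u a w (≡ᵇ≡true⇒≡ e))

  newBlockCount-insertCount : ∀ {k} (w : Vec (Fin k) p) →
    newBlockCount w ≡ 𝟙 (constantOnFibres u w) * insertCount b (blocksOf u w)
  newBlockCount-insertCount {k} w = trans (sum-cong-≗ term)
    (sym (*-distribˡ-sum (𝟙 (constantOnFibres u w)) (λ a → 𝟙 (admissible (insertAt a (b , true) (blocksOf u w))))))
    where
    term : ∀ a → 𝟙 (Valid (b ∷ u) (a ∷ map (punchIn a) w))
               ≡ 𝟙 (constantOnFibres u w) * 𝟙 (admissible (insertAt a (b , true) (blocksOf u w)))
    term a = trans (cong₂ (λ c L → 𝟙 (c ∧ admissible L)) agree (blocksOf-insert b u a w))
                   (𝟙-∧ (constantOnFibres u w) (admissible (insertAt a (b , true) (blocksOf u w))))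
      where
      agree : constantOnFibres (b ∷ u) (a ∷ map (punchIn a) w) ≡ constantOnFibres u w
      agree rewrite occurs-pivot-punchIn a w = constantOnFibres-punchIn a u w

  joinCount-newBlockCount : ∀ {k} (w : Vec (Fin k) p) →
    𝟙 (onto w) * (joinCount w - newBlockCount w) ≡ - ((1ℤ + 𝟙 (occursℕ b u)) * 𝟙 (onto w ∧ Valid u w))
  joinCount-newBlockCount {k} w with onto w in hs
  ... | false = sym (cong -_ (ℤP.*-zeroʳ (1ℤ + 𝟙 (occursℕ b u))))
  ... | true rewrite joinCount-flipCount w hs | newBlockCount-insertCount w =
    difference (constantOnFibres u w) (λ agree → trans (insertCount-flipCount b L)
                                           (cong (λ m → F + (1ℤ + 𝟙 m) * 𝟙 (admissible L)) (hasLabel-blocksOf b u w agree hs)))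
    where
    L : Vec Block k
    L = blocksOf u w
    F I : ℤ
    F = flipCount b L
    I = insertCount b L
    difference : ∀ C → (C ≡ true → I ≡ F + (1ℤ + 𝟙 (occursℕ b u)) * 𝟙 (admissible L)) →
      1ℤ * (𝟙 C * F - 𝟙 C * I) ≡ - ((1ℤ + 𝟙 (occursℕ b u)) * 𝟙 (C ∧ admissible L))
    difference false h = sym (cong -_ (ℤP.*-zeroʳ (1ℤ + 𝟙 (occursℕ b u))))
    difference true h rewrite h refl = ring F (𝟙 (occursℕ b u)) (𝟙 (admissible L))
      where
      ring : ∀ f m v → 1ℤ * (1ℤ * f - 1ℤ * (f + (1ℤ + m) * v)) ≡ - ((1ℤ + m) * v)
      ring = solve-∀

  joinTotal : ℕ → ℤ
  joinTotal ℓ = sumVecs ℓ p (λ w → 𝟙 (onto w) * joinCount w)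

  newTotal : ℕ → ℤ
  newTotal zero = 0ℤ
  newTotal (suc k) = sumVecs k p (λ w → 𝟙 (onto w) * newBlockCount w)

  validCount-cons : ∀ ℓ → validCount ℓ (b ∷ u) ≡ joinTotal ℓ + newTotal ℓ
  validCount-cons ℓ = begin
    ∑[ a < ℓ ] sumVecs ℓ p (λ w → 𝟙 (onto (a ∷ w) ∧ V a w))
      ≡⟨ sum-cong-≗ (λ a → trans (sumVecs-cong ℓ p (λ w → 𝟙-onto-split a w (V a w)))
                                  (sumVecs-+ ℓ p (λ w → 𝟙 (onto w ∧ V a w)) (λ w → 𝟙 (not (occurs a w)) * K a w))) ⟩
    ∑[ a < ℓ ] (sumVecs ℓ p (λ w → 𝟙 (onto w ∧ V a w)) + sumVecs ℓ p (λ w → 𝟙 (not (occurs a w)) * K a w))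
      ≡⟨ ∑-distrib-+ (λ a → sumVecs ℓ p (λ w → 𝟙 (onto w ∧ V a w))) (λ a → sumVecs ℓ p (λ w → 𝟙 (not (occurs a w)) * K a w)) ⟩
    ∑[ a < ℓ ] sumVecs ℓ p (λ w → 𝟙 (onto w ∧ V a w)) + ∑[ a < ℓ ] sumVecs ℓ p (λ w → 𝟙 (not (occurs a w)) * K a w)
      ≡⟨ cong₂ _+_ joined (created ℓ) ⟩
    joinTotal ℓ + newTotal ℓ ∎
    where
    open ≡-Reasoning
    V : ∀ {ℓ} → Fin ℓ → Vec (Fin ℓ) p → Bool
    V a w = Valid (b ∷ u) (a ∷ w)
    K : ∀ {ℓ} → Fin ℓ → Vec (Fin ℓ) p → ℤ
    K a w = 𝟙 (onto (a ∷ w) ∧ V a w)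
    joined : ∑[ a < ℓ ] sumVecs ℓ p (λ w → 𝟙 (onto w ∧ V a w)) ≡ joinTotal ℓ
    joined = trans (sum-sumVecs-comm ℓ ℓ p (λ a w → 𝟙 (onto w ∧ V a w)))
      (sumVecs-cong ℓ p (λ w → trans (sum-cong-≗ (λ a → 𝟙-∧ (onto w) (V a w)))
                                     (sym (*-distribˡ-sum (𝟙 (onto w)) (λ a → 𝟙 (V a w))))))
    created : ∀ ℓ → ∑[ a < ℓ ] sumVecs ℓ p (λ w → 𝟙 (not (occurs a w)) * K a w) ≡ newTotal ℓ
    created zero = refl
    created (suc k) = begin
      ∑[ a < suc k ] sumVecs (suc k) p (λ w → 𝟙 (not (occurs a w)) * K a w)
        ≡⟨ sum-cong-≗ (λ a → trans (sumVecs-avoid k p a (K a)) (sumVecs-cong k p (λ w → factor a w))) ⟩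
      ∑[ a < suc k ] sumVecs k p (λ w → 𝟙 (onto w) * 𝟙 (V a (map (punchIn a) w)))
        ≡⟨ sum-sumVecs-comm (suc k) k p (λ a w → 𝟙 (onto w) * 𝟙 (V a (map (punchIn a) w))) ⟩
      sumVecs k p (λ w → ∑[ a < suc k ] (𝟙 (onto w) * 𝟙 (V a (map (punchIn a) w))))
        ≡⟨ sumVecs-cong k p (λ w → sym (*-distribˡ-sum (𝟙 (onto w)) (λ a → 𝟙 (V a (map (punchIn a) w))))) ⟩
      newTotal (suc k) ∎
      where
      factor : ∀ a w → K a (map (punchIn a) w) ≡ 𝟙 (onto w) * 𝟙 (V a (map (punchIn a) w))
      factor a w = trans (cong (λ z → 𝟙 (z ∧ V a (map (punchIn a) w))) (onto-pivot-punchIn a w))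
                         (𝟙-∧ (onto w) (V a (map (punchIn a) w)))

  joinTotal-newTotal : ∀ k → joinTotal k - newTotal (suc k) ≡ - ((1ℤ + 𝟙 (occursℕ b u)) * validCount k u)
  joinTotal-newTotal k = begin
    joinTotal k - newTotal (suc k)
      ≡⟨ cong (λ t → joinTotal k + t) (sym (sumVecs-neg k p (λ w → 𝟙 (onto w) * newBlockCount w))) ⟩
    joinTotal k + sumVecs k p (λ w → - (𝟙 (onto w) * newBlockCount w))
      ≡⟨ sym (sumVecs-+ k p (λ w → 𝟙 (onto w) * joinCount w) (λ w → - (𝟙 (onto w) * newBlockCount w))) ⟩
    sumVecs k p (λ w → 𝟙 (onto w) * joinCount w + - (𝟙 (onto w) * newBlockCount w))
      ≡⟨ sumVecs-cong k p (λ w → trans (factor w) (joinCount-newBlockCount w)) ⟩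
    sumVecs k p (λ w → - ((1ℤ + 𝟙 (occursℕ b u)) * 𝟙 (onto w ∧ Valid u w)))
      ≡⟨ sumVecs-neg k p (λ w → (1ℤ + 𝟙 (occursℕ b u)) * 𝟙 (onto w ∧ Valid u w)) ⟩
    - sumVecs k p (λ w → (1ℤ + 𝟙 (occursℕ b u)) * 𝟙 (onto w ∧ Valid u w))
      ≡⟨ cong -_ (sumVecs-* k p (1ℤ + 𝟙 (occursℕ b u)) (λ w → 𝟙 (onto w ∧ Valid u w))) ⟩
    - ((1ℤ + 𝟙 (occursℕ b u)) * validCount k u) ∎
    where
    open ≡-Reasoning
    factor : ∀ w → 𝟙 (onto w) * joinCount w + - (𝟙 (onto w) * newBlockCount w)
                   ≡ 𝟙 (onto w) * (joinCount w - newBlockCount w)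
    factor w = trans (cong (λ t → 𝟙 (onto w) * joinCount w + t) (ℤP.neg-distribʳ-* (𝟙 (onto w)) (newBlockCount w)))
                     (sym (ℤP.*-distribˡ-+ (𝟙 (onto w)) (joinCount w) (- newBlockCount w)))

signedValidCount-formula : ∀ p (u : Vec ℕ p) N → p < N → signedValidCount N u ≡ (+ 2) ^ repeats u * -1ℤ ^ p
signedValidCount-formula zero [] (suc N) _ =
  cong (λ t → 1ℤ + t) (trans (sum-cong-≗ {n = N} (λ ℓ → ℤP.*-zeroʳ (-1ℤ ^ suc (toℕ ℓ)))) (sum-replicate-zero N))
signedValidCount-formula (suc p) (b ∷ u) (suc N) (s≤s p<N) = begin
  signedValidCount (suc N) (b ∷ u)
    ≡⟨ sum-cong-≗ {n = suc N} (λ ℓ → trans (cong (-1ℤ ^ toℕ ℓ *_) (validCount-cons (toℕ ℓ)))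
                               (ℤP.*-distribˡ-+ (-1ℤ ^ toℕ ℓ) (joinTotal (toℕ ℓ)) (newTotal (toℕ ℓ)))) ⟩
  ∑[ ℓ < suc N ] (joinTerm (toℕ ℓ) + newTerm (toℕ ℓ))
    ≡⟨ ∑-distrib-+ {n = suc N} (λ ℓ → joinTerm (toℕ ℓ)) (λ ℓ → newTerm (toℕ ℓ)) ⟩
  ∑[ ℓ < suc N ] joinTerm (toℕ ℓ) + ∑[ ℓ < suc N ] newTerm (toℕ ℓ)
    ≡⟨ cong₂ _+_ dropLast (ℤP.+-identityˡ _) ⟩
  ∑[ k < N ] joinTerm (toℕ k) + ∑[ k < N ] newTerm (suc (toℕ k))
    ≡⟨ ∑-distrib-+ {n = N} (λ k → joinTerm (toℕ k)) (λ k → newTerm (suc (toℕ k))) ⟨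
  ∑[ k < N ] (joinTerm (toℕ k) + newTerm (suc (toℕ k)))
    ≡⟨ sum-cong-≗ {n = N} (λ k → pair (toℕ k)) ⟩
  ∑[ k < N ] (- c * (-1ℤ ^ toℕ k * validCount (toℕ k) u))
    ≡⟨ *-distribˡ-sum {n = N} (- c) (λ k → -1ℤ ^ toℕ k * validCount (toℕ k) u) ⟨
  - c * signedValidCount N u
    ≡⟨ cong (- c *_) (signedValidCount-formula p u N p<N) ⟩
  - c * ((+ 2) ^ repeats u * -1ℤ ^ p)
    ≡⟨ closing (occursℕ b u) refl ⟩
  (+ 2) ^ repeats (b ∷ u) * -1ℤ ^ suc p ∎
  where
  open ≡-Reasoning
  open AddPoint b u
  c : ℤ
  c = 1ℤ + 𝟙 (occursℕ b u)
  joinTerm newTerm : ℕ → ℤ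
  joinTerm ℓ = -1ℤ ^ ℓ * joinTotal ℓ
  newTerm ℓ = -1ℤ ^ ℓ * newTotal ℓ
  dropLast : ∑[ ℓ < suc N ] joinTerm (toℕ ℓ) ≡ ∑[ k < N ] joinTerm (toℕ k)
  dropLast = trans (sum-last N joinTerm) (trans (cong (λ t → ∑[ k < N ] joinTerm (toℕ k) + -1ℤ ^ N * t)
                                               (sumVecs-onto-vanish N joinCount p<N))
                                         (trans (cong (λ t → ∑[ k < N ] joinTerm (toℕ k) + t) (ℤP.*-zeroʳ (-1ℤ ^ N)))
                                                (ℤP.+-identityʳ _)))
  pair : ∀ k → joinTerm k + newTerm (suc k) ≡ - c * (-1ℤ ^ k * validCount k u)
  pair k = trans (ring (-1ℤ ^ k) (joinTotal k) (newTotal (suc k)))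
                 (trans (cong (-1ℤ ^ k *_) (joinTotal-newTotal k)) (ring′ (-1ℤ ^ k) c (validCount k u)))
    where
    ring : ∀ s a n → s * a + (-1ℤ * s) * n ≡ s * (a - n)
    ring = solve-∀
    ring′ : ∀ s m v → s * - (m * v) ≡ - m * (s * v)
    ring′ = solve-∀
  closing : ∀ m → occursℕ b u ≡ m →
    - (1ℤ + 𝟙 m) * ((+ 2) ^ repeats u * -1ℤ ^ p) ≡ (+ 2) ^ repeats (b ∷ u) * -1ℤ ^ suc p
  closing true e rewrite e = ring ((+ 2) ^ repeats u) (-1ℤ ^ p)
    where
    ring : ∀ t s → - (1ℤ + 1ℤ) * (t * s) ≡ (+ 2 * t) * (-1ℤ * s)
    ring = solve-∀
  closing false e rewrite e = ring ((+ 2) ^ repeats u) (-1ℤ ^ p)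
    where
    ring : ∀ t s → - (1ℤ + 0ℤ) * (t * s) ≡ t * (-1ℤ * s)
    ring = solve-∀

bit : Bool → ℕ
bit true = 1
bit false = 0

-- The number of odd blocks before block j: the index of the block of Odd(φ)
-- containing φ_j.
runIndex : ∀ {k} → Vec Block k → Fin k → ℕ
runIndex (x ∷ L) Fin.zero = 0
runIndex (x ∷ L) (Fin.suc j) = bit (proj₂ x) ℕ.+ runIndex L j

labelAt : ∀ {k} → Vec Block k → Fin k → ℕ
labelAt L j = proj₁ (lookup L j)

oddAt : ∀ {k} → Vec Block k → Fin k → Bool
oddAt L j = proj₂ (lookup L j)

runIndex-mono : ∀ {k} (L : Vec Block k) j j′ → toℕ j ≤ toℕ j′ → runIndex L j ≤ runIndex L j′
runIndex-mono (x ∷ L) Fin.zero j′ le = z≤n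
runIndex-mono (x ∷ L) (Fin.suc j) (Fin.suc j′) (s≤s le) = ℕP.+-monoʳ-≤ (bit (proj₂ x)) (runIndex-mono L j j′ le)

runIndex-≤-last : ∀ {k} (L : Vec Block (suc k)) j → runIndex L j ≤ runIndex L (fromℕ k)
runIndex-≤-last {k} L j = runIndex-mono L j (fromℕ k) (subst (toℕ j ≤_) (sym (FP.toℕ-fromℕ k)) (FP.toℕ≤pred[n] j))

runIndex-onto : ∀ {k} (L : Vec Block (suc k)) r → r ≤ runIndex L (fromℕ k) → ∃ λ j → runIndex L j ≡ r
runIndex-onto {zero} (x ∷ []) zero le = Fin.zero , refl
runIndex-onto {suc k} (x ∷ L) zero le = Fin.zero , refl
runIndex-onto {suc k} ((c , true) ∷ L) (suc r) (s≤s le) with runIndex-onto L r le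
... | j , e = Fin.suc j , cong suc e
runIndex-onto {suc k} ((c , false) ∷ L) (suc r) le with runIndex-onto L (suc r) le
... | j , e = Fin.suc j , e

admissible⇒lastOdd : ∀ {k} (L : Vec Block (suc k)) → admissible L ≡ true → oddAt L (fromℕ k) ≡ true
admissible⇒lastOdd {zero} ((c , o) ∷ []) v = ∧≡true⇒ˡ _ _ v
admissible⇒lastOdd {suc k} (x ∷ L) v = admissible⇒lastOdd L (∧≡true⇒ʳ _ _ v)

admissible⇒labels-mono : ∀ {k} (L : Vec Block k) → admissible L ≡ true →
  ∀ j j′ → runIndex L j ≤ runIndex L j′ → labelAt L j ≤ labelAt L j′
admissible⇒labels-mono (x ∷ L) v Fin.zero Fin.zero le = ℕP.≤-refl
admissible⇒labels-mono ((c , o) ∷ (d , o′) ∷ L) v Fin.zero (Fin.suc j) le =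
  ℕP.≤-trans (≤ᵇ≡true⇒≤ (∧≡true⇒ˡ _ _ (∧≡true⇒ˡ _ _ v)))
             (admissible⇒labels-mono ((d , o′) ∷ L) (∧≡true⇒ʳ (canPrecede (c , o) d) _ v) Fin.zero j z≤n)
admissible⇒labels-mono ((c , false) ∷ (d , o′) ∷ L) v (Fin.suc j) Fin.zero le
  rewrite ≡ᵇ≡true⇒≡ {c} {d} (∧≡true⇒ʳ (c ≤ᵇ d) _ (∧≡true⇒ˡ (canPrecede (c , false) d) _ v)) =
  admissible⇒labels-mono ((d , o′) ∷ L) (∧≡true⇒ʳ (canPrecede (c , false) d) _ v) j Fin.zero le
admissible⇒labels-mono ((c , true) ∷ (d , o′) ∷ L) v (Fin.suc j) Fin.zero ()
admissible⇒labels-mono ((c , o) ∷ L) v (Fin.suc j) (Fin.suc j′) le =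
  admissible⇒labels-mono L (∧≡true⇒ʳ _ _ v) j j′ (ℕP.+-cancelˡ-≤ (bit o) _ _ le)

labels-by-runs⇒admissible : ∀ {k} (L : Vec Block (suc k)) (h : ℕ → ℕ) → (∀ r r′ → r ≤ r′ → h r ≤ h r′) →
  (∀ j → labelAt L j ≡ h (runIndex L j)) → oddAt L (fromℕ k) ≡ true → admissible L ≡ true
labels-by-runs⇒admissible {zero} ((c , o) ∷ []) h mono hl hp rewrite hp = refl
labels-by-runs⇒admissible {suc k} ((c , o) ∷ (d , o′) ∷ L) h mono hl hp = link o (hl (Fin.suc Fin.zero))
  where
  rest : admissible ((d , o′) ∷ L) ≡ true
  rest = labels-by-runs⇒admissible ((d , o′) ∷ L) (λ r → h (bit o ℕ.+ r))
           (λ r r′ le → mono _ _ (ℕP.+-monoʳ-≤ (bit o) le)) (λ j → hl (Fin.suc j)) hp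
  link : ∀ o → d ≡ h (bit o ℕ.+ 0) → canPrecede (c , o) d ∧ admissible ((d , o′) ∷ L) ≡ true
  link true e rewrite ≤⇒≤ᵇ≡true (subst₂ _≤_ (sym (hl Fin.zero)) (sym e) (mono 0 1 z≤n)) = rest
  link false e rewrite ≤⇒≤ᵇ≡true (subst₂ _≤_ (sym (hl Fin.zero)) (sym e) ℕP.≤-refl)
                     | subst (λ z → (c ≡ᵇ z) ≡ true) (trans (hl Fin.zero) (sym e)) (≡ᵇ-refl c) = rest

countᶠ-false : ∀ k → countᶠ k (λ _ → false) ≡ 0
countᶠ-false zero = refl
countᶠ-false (suc k) = countᶠ-false k

countᶠ-cong : ∀ k {f g : Fin k → Bool} → (∀ i → f i ≡ g i) → countᶠ k f ≡ countᶠ k g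
countᶠ-cong zero e = refl
countᶠ-cong (suc k) {f} {g} e rewrite e Fin.zero | countᶠ-cong k {λ i → f (Fin.suc i)} {λ i → g (Fin.suc i)} (λ i → e (Fin.suc i)) = refl

runIndex-tabulate : ∀ {ℓ} (f : Fin ℓ → Block) j →
  runIndex (tabulate f) j ≡ countᶠ ℓ (λ j′ → (toℕ j′ <ᵇ toℕ j) ∧ proj₂ (f j′))
runIndex-tabulate {suc ℓ} f Fin.zero = sym (countᶠ-false ℓ)
runIndex-tabulate {suc ℓ} f (Fin.suc j) with proj₂ (f Fin.zero)
... | true = cong suc (runIndex-tabulate (λ i → f (Fin.suc i)) j)
... | false = runIndex-tabulate (λ i → f (Fin.suc i)) j

toℕ-clamp : ∀ r m → toℕ (clamp r m) ≡ r ⊓ m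
toℕ-clamp zero m = refl
toℕ-clamp (suc r) zero = refl
toℕ-clamp (suc r) (suc m) = cong suc (toℕ-clamp r m)

toℕ-clamp-≤ : ∀ r m → r ≤ m → toℕ (clamp r m) ≡ r
toℕ-clamp-≤ r m le = trans (toℕ-clamp r m) (ℕP.m≤n⇒m⊓n≡m le)

clamp-mono : ∀ r r′ m → r ≤ r′ → toℕ (clamp r m) ≤ toℕ (clamp r′ m)
clamp-mono r r′ m le = subst₂ _≤_ (sym (toℕ-clamp r m)) (sym (toℕ-clamp r′ m)) (ℕP.⊓-monoˡ-≤ m le)

module Parity = SemiringSum (CommutativeRing.semiring BP.xor-∧-commutativeRing)

xorSum : ∀ {k} → (Fin k → Bool) → Bool
xorSum = Parity.sum

isOdd-countᶠ : ∀ k h → isOdd (countᶠ k h) ≡ xorSum h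
isOdd-countᶠ zero h = refl
isOdd-countᶠ (suc k) h with h Fin.zero
... | true = trans (isOdd-suc (countᶠ k (λ i → h (Fin.suc i)))) (cong not (isOdd-countᶠ k (λ i → h (Fin.suc i))))
... | false = isOdd-countᶠ k (λ i → h (Fin.suc i))

isOdd-fibreSize : ∀ {ℓ P} (w : Vec (Fin ℓ) P) j → isOdd (fibreSize w j) ≡ xorSum (λ i → lookup w i == j)
isOdd-fibreSize [] j = refl
isOdd-fibreSize (a ∷ w) j with a == j
... | true = trans (isOdd-suc (fibreSize w j)) (cong not (isOdd-fibreSize w j))
... | false = isOdd-fibreSize w j

xorSum-delta : ∀ {k} (a : Fin k) (g : Fin k → Bool) → xorSum (λ i → (a == i) ∧ g i) ≡ g a
xorSum-delta {suc k} Fin.zero g = trans (cong (g Fin.zero xor_) (Parity.sum-replicate-zero k)) (BP.xor-identityʳ (g Fin.zero))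
xorSum-delta {suc k} (Fin.suc a) g = xorSum-delta a (λ i → g (Fin.suc i))

xorSum-oddFibres : ∀ {n P} (π : Fin n → Fin P) → (∀ i → xorSum (λ x → π x == i) ≡ true) →
  ∀ (g : Fin P → Bool) → xorSum (λ x → g (π x)) ≡ xorSum g
xorSum-oddFibres {n} {P} π oddFibres g = begin
  xorSum (λ x → g (π x))
    ≡⟨ Parity.sum-cong-≗ (λ x → sym (xorSum-delta (π x) g)) ⟩
  xorSum (λ x → xorSum (λ i → (π x == i) ∧ g i))
    ≡⟨ Parity.∑-comm (λ x i → (π x == i) ∧ g i) ⟩
  xorSum (λ i → xorSum (λ x → (π x == i) ∧ g i))
    ≡⟨ Parity.sum-cong-≗ (λ i → trans (sym (Parity.*-distribʳ-sum (g i) (λ x → π x == i))) (cong (_∧ g i) (oddFibres i))) ⟩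
  xorSum g ∎
  where open ≡-Reasoning

surjective?-unfold : ∀ {n} (φ : Labelling n) →
  surjective? φ ≡ allᶠ (len φ) (λ j → anyᶠ n (λ x → blk φ x == j))
surjective?-unfold {n} φ = trans (all-allFin (len φ) _) (allᶠ-cong (len φ) (λ j → any-allFin n _))

surjective?⇒ : ∀ {n} (φ : Labelling n) → surjective? φ ≡ true → ∀ j → ∃ λ x → blk φ x ≡ j
surjective?⇒ {n} φ h j with anyᶠ⇒ n _ (allᶠ⇒ (len φ) _ (trans (sym (surjective?-unfold φ)) h) j)
... | x , e = x , ==⇒≡ _ _ e

unionOfBlocks?-unfold : ∀ {n} (π φ : Labelling n) → unionOfBlocks? π φ
  ≡ allᶠ n (λ x → allᶠ n (λ y → not (blk π x == blk π y) ∨ (blk φ x == blk φ y)))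
unionOfBlocks?-unfold {n} π φ = trans (all-allFin n _) (allᶠ-cong n (λ x → all-allFin n _))

unionOfBlocks?⇒ : ∀ {n} (π φ : Labelling n) → unionOfBlocks? π φ ≡ true →
  ∀ x y → blk π x ≡ blk π y → blk φ x ≡ blk φ y
unionOfBlocks?⇒ {n} π φ h x y e = ==⇒≡ _ _ (same (allᶠ⇒ n _ (allᶠ⇒ n _ (trans (sym (unionOfBlocks?-unfold π φ)) h) x) y))
  where
  same : (not (blk π x == blk π y) ∨ (blk φ x == blk φ y)) ≡ true → (blk φ x == blk φ y) ≡ true
  same h′ rewrite e | ==-refl (blk π y) = h′

⇒unionOfBlocks? : ∀ {n} (π φ : Labelling n) → (∀ x y → blk π x ≡ blk π y → blk φ x ≡ blk φ y) →
  unionOfBlocks? π φ ≡ true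
⇒unionOfBlocks? {n} π φ h = trans (unionOfBlocks?-unfold π φ) (⇒allᶠ n _ (λ x → ⇒allᶠ n _ (λ y → implication x y)))
  where
  implication : ∀ x y → (not (blk π x == blk π y) ∨ (blk φ x == blk φ y)) ≡ true
  implication x y with blk π x == blk π y in e
  ... | false = refl
  ... | true rewrite h x y (==⇒≡ _ _ e) = ==-refl (blk φ y)

Monotone : ∀ {a b} → Vec (Fin b) a → Set
Monotone {a} g = ∀ (i j : Fin a) → toℕ i ≤ toℕ j → toℕ (lookup g i) ≤ toℕ (lookup g j)

monotone?-unfold : ∀ {a b} (g : Vec (Fin b) a) →
  monotone? g ≡ allᶠ a (λ i → allᶠ a (λ j → not (toℕ i ≤ᵇ toℕ j) ∨ (toℕ (lookup g i) ≤ᵇ toℕ (lookup g j))))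
monotone?-unfold {a} g = trans (all-allFin a _) (allᶠ-cong a (λ i → all-allFin a _))

monotone?⇒ : ∀ {a b} (g : Vec (Fin b) a) → monotone? g ≡ true → Monotone g
monotone?⇒ {a} g h i j le = ≤ᵇ≡true⇒≤ (conclusion (allᶠ⇒ a _ (allᶠ⇒ a _ (trans (sym (monotone?-unfold g)) h) i) j))
  where
  conclusion : (not (toℕ i ≤ᵇ toℕ j) ∨ (toℕ (lookup g i) ≤ᵇ toℕ (lookup g j))) ≡ true →
    (toℕ (lookup g i) ≤ᵇ toℕ (lookup g j)) ≡ true
  conclusion e rewrite ≤⇒≤ᵇ≡true le = e

⇒monotone? : ∀ {a b} (g : Vec (Fin b) a) → Monotone g → monotone? g ≡ true
⇒monotone? {a} g h = trans (monotone?-unfold g) (⇒allᶠ a _ (λ i → ⇒allᶠ a _ (λ j → implication i j)))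
  where
  implication : ∀ i j → (not (toℕ i ≤ᵇ toℕ j) ∨ (toℕ (lookup g i) ≤ᵇ toℕ (lookup g j))) ≡ true
  implication i j with toℕ i ≤ᵇ toℕ j in e
  ... | false = refl
  ... | true = ≤⇒≤ᵇ≡true (h i j (≤ᵇ≡true⇒≤ e))

any-allVecs⇒ : ∀ k n (f : Vec (Fin k) n → Bool) → any f (allVecs k n) ≡ true → ∃ λ v → f v ≡ true
any-allVecs⇒ k zero f h with f [] in e
... | true = [] , e
any-allVecs⇒ k (suc n) f h with any-allVecs⇒ k n _ (trans (sym (any-allVecs-suc k n f)) h)
... | v , e with anyᶠ⇒ k _ e
... | a , e′ = a ∷ v , e′

⇒any-allVecs : ∀ k n (f : Vec (Fin k) n → Bool) v → f v ≡ true → any f (allVecs k n) ≡ true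
⇒any-allVecs k zero f [] h rewrite h = refl
⇒any-allVecs k (suc n) f (a ∷ v) h = trans (any-allVecs-suc k n f)
  (⇒any-allVecs k n (λ v → anyᶠ k (λ a → f (a ∷ v))) v (⇒anyᶠ k _ a h))

refinedBy?-unfold : ∀ {n} (ψ χ : Labelling n) → refinedBy? ψ χ
  ≡ any (λ g → monotone? g ∧ allᶠ n (λ x → blk ψ x == lookup g (blk χ x))) (allVecs (len ψ) (len χ))
refinedBy?-unfold {n} ψ χ = cong or (LP.map-cong (λ g → cong (monotone? g ∧_) (all-allFin n _)) (allVecs (len ψ) (len χ)))

refinedBy?⇒ : ∀ {n} (ψ χ : Labelling n) → refinedBy? ψ χ ≡ true →
  ∃ λ g → Monotone g × (∀ x → blk ψ x ≡ lookup g (blk χ x))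
refinedBy?⇒ {n} ψ χ h with any-allVecs⇒ (len ψ) (len χ) _ (trans (sym (refinedBy?-unfold ψ χ)) h)
... | g , e = g , monotone?⇒ g (∧≡true⇒ˡ _ _ e) , (λ x → ==⇒≡ _ _ (allᶠ⇒ n _ (∧≡true⇒ʳ (monotone? g) _ e) x))

⇒refinedBy? : ∀ {n} (ψ χ : Labelling n) (g : Vec (Fin (len ψ)) (len χ)) → Monotone g →
  (∀ x → blk ψ x ≡ lookup g (blk χ x)) → refinedBy? ψ χ ≡ true
⇒refinedBy? {n} ψ χ g mono factors = trans (refinedBy?-unfold ψ χ) (⇒any-allVecs (len ψ) (len χ) _ g
  (trans (cong (_∧ allᶠ n (λ x → blk ψ x == lookup g (blk χ x))) (⇒monotone? g mono))
         (⇒allᶠ n _ (λ x → subst (λ z → (blk ψ x == z) ≡ true) (factors x) (==-refl (blk ψ x))))))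

blockSize-countᶠ : ∀ {n ℓ} (v : Vec (Fin ℓ) n) j → blockSize (ℓ , v) j ≡ countᶠ n (λ x → lookup v x == j)
blockSize-countᶠ {n} v j = length-filter-allFin n (λ x → lookup v x == j) _

oddBefore-countᶠ : ∀ {n ℓ} (v : Vec (Fin ℓ) n) t →
  oddBefore (ℓ , v) t ≡ countᶠ ℓ (λ j → (toℕ j <ᵇ t) ∧ isOdd (blockSize (ℓ , v) j))
oddBefore-countᶠ {n} {ℓ} v t = length-filter-allFin ℓ (λ j → (toℕ j <ᵇ t) ∧ isOdd (blockSize (ℓ , v) j)) _

⇒constantOnFibres : ∀ {k p} (u : Vec ℕ p) (w : Vec (Fin k) p) →
  (∀ i i′ → lookup w i ≡ lookup w i′ → lookup u i ≡ lookup u i′) → constantOnFibres u w ≡ true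
⇒constantOnFibres [] [] h = refl
⇒constantOnFibres (b ∷ u) (a ∷ w) h = trans (cong (_∧ constantOnFibres u w) headAgrees) rest
  where
  rest : constantOnFibres u w ≡ true
  rest = ⇒constantOnFibres u w (λ i i′ e → h (Fin.suc i) (Fin.suc i′) e)
  headAgrees : (not (occurs a w) ∨ (fibreLabel u w a ≡ᵇ b)) ≡ true
  headAgrees with occurs a w in e
  ... | false = refl
  ... | true with occurs⇒ a w e
  ... | x , refl rewrite fibreLabel-lookup u w rest x | h (Fin.suc x) Fin.zero refl = ≡ᵇ-refl b

-- Labellings of [n] whose blocks are unions of blocks of (P , πv) are the
-- maps w from the P blocks, composed with πv.
module Coarsening {n P : ℕ} (πv : Vec (Fin P) n) (π-onto : surjective? (P , πv) ≡ true) where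

  coarsen : ∀ {ℓ} → Vec (Fin ℓ) P → Vec (Fin ℓ) n
  coarsen w = map (lookup w) πv

  lookup-coarsen : ∀ {ℓ} (w : Vec (Fin ℓ) P) x → lookup (coarsen w) x ≡ lookup w (lookup πv x)
  lookup-coarsen w x = VP.lookup-map x (lookup w) πv

  rep : Fin P → Fin n
  rep i = proj₁ (surjective?⇒ (P , πv) π-onto i)

  lookup-rep : ∀ i → lookup πv (rep i) ≡ i
  lookup-rep i = proj₂ (surjective?⇒ (P , πv) π-onto i)

  P≤n : P ≤ n
  P≤n = section⇒≤ rep (lookup πv) lookup-rep

  countCoarsenings : ∀ {ℓ} (v : Vec (Fin ℓ) n) →
    sumVecs ℓ P (λ w → 𝟙 (sameVec v (coarsen w))) ≡ 𝟙 (unionOfBlocks? (P , πv) (ℓ , v))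
  countCoarsenings {ℓ} v with unionOfBlocks? (P , πv) (ℓ , v) in union
  ... | true = trans (sumVecs-cong ℓ P (λ w → trans (cong 𝟙 (true-iff⇒≡ _ _ (to w) (from w))) (sym (ℤP.*-identityʳ _))))
                     (sumVecs-delta ℓ P w₀ (λ _ → 1ℤ))
    where
    w₀ : Vec (Fin ℓ) P
    w₀ = tabulate (λ i → lookup v (rep i))
    to : ∀ w → sameVec v (coarsen w) ≡ true → sameVec w w₀ ≡ true
    to w h = ⇒sameVec w w₀ (λ i → begin
      lookup w i                  ≡⟨ cong (lookup w) (lookup-rep i) ⟨
      lookup w (lookup πv (rep i)) ≡⟨ lookup-coarsen w (rep i) ⟨
      lookup (coarsen w) (rep i)   ≡⟨ sameVec⇒ v (coarsen w) h (rep i) ⟨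
      lookup v (rep i)             ≡⟨ VP.lookup∘tabulate (λ i → lookup v (rep i)) i ⟨
      lookup w₀ i                  ∎)
      where open ≡-Reasoning
    from : ∀ w → sameVec w w₀ ≡ true → sameVec v (coarsen w) ≡ true
    from w h = ⇒sameVec v (coarsen w) (λ x → begin
      lookup v x                       ≡⟨ unionOfBlocks?⇒ (P , πv) (ℓ , v) union x (rep (lookup πv x)) (sym (lookup-rep _)) ⟩
      lookup v (rep (lookup πv x))     ≡⟨ VP.lookup∘tabulate (λ i → lookup v (rep i)) (lookup πv x) ⟨
      lookup w₀ (lookup πv x)          ≡⟨ sameVec⇒ w w₀ h (lookup πv x) ⟨
      lookup w (lookup πv x)           ≡⟨ lookup-coarsen w x ⟨
      lookup (coarsen w) x             ∎)
      where open ≡-Reasoning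
  ... | false = trans (sumVecs-cong ℓ P (λ w → cong 𝟙 (notCoarsening w))) (sumVecs-zero ℓ P)
    where
    notCoarsening : ∀ w → sameVec v (coarsen w) ≡ false
    notCoarsening w with sameVec v (coarsen w) in e
    ... | false = refl
    ... | true = ⊥-elim (true≢false (trans (sym (⇒unionOfBlocks? (P , πv) (ℓ , v) factors)) union))
      where
      factors : ∀ x y → lookup πv x ≡ lookup πv y → lookup v x ≡ lookup v y
      factors x y exy = begin
        lookup v x              ≡⟨ sameVec⇒ v (coarsen w) e x ⟩
        lookup (coarsen w) x    ≡⟨ lookup-coarsen w x ⟩
        lookup w (lookup πv x)  ≡⟨ cong (lookup w) exy ⟩
        lookup w (lookup πv y)  ≡⟨ lookup-coarsen w y ⟨
        lookup (coarsen w) y    ≡⟨ sameVec⇒ v (coarsen w) e y ⟨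
        lookup v y              ∎
        where open ≡-Reasoning

  sumVecs-coarsen : ∀ ℓ (G : Vec (Fin ℓ) n → ℤ) →
    sumVecs ℓ P (λ w → G (coarsen w)) ≡ sumVecs ℓ n (λ v → 𝟙 (unionOfBlocks? (P , πv) (ℓ , v)) * G v)
  sumVecs-coarsen ℓ G = begin
    sumVecs ℓ P (λ w → G (coarsen w))
      ≡⟨ sumVecs-cong ℓ P (λ w → sym (sumVecs-delta ℓ n (coarsen w) G)) ⟩
    sumVecs ℓ P (λ w → sumVecs ℓ n (λ v → 𝟙 (sameVec v (coarsen w)) * G v))
      ≡⟨ sumVecs-comm ℓ P ℓ n (λ w v → 𝟙 (sameVec v (coarsen w)) * G v) ⟩
    sumVecs ℓ n (λ v → sumVecs ℓ P (λ w → 𝟙 (sameVec v (coarsen w)) * G v))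
      ≡⟨ sumVecs-cong ℓ n (λ v → trans (sumVecs-cong ℓ P (λ w → ℤP.*-comm (𝟙 (sameVec v (coarsen w))) (G v)))
                                (trans (sumVecs-* ℓ P (G v) (λ w → 𝟙 (sameVec v (coarsen w))))
                                  (trans (cong (G v *_) (countCoarsenings v)) (ℤP.*-comm (G v) _)))) ⟩
    sumVecs ℓ n (λ v → 𝟙 (unionOfBlocks? (P , πv) (ℓ , v)) * G v) ∎
    where open ≡-Reasoning

  surjective?-coarsen : ∀ {ℓ} (w : Vec (Fin ℓ) P) → surjective? (ℓ , coarsen w) ≡ onto w
  surjective?-coarsen {ℓ} w = trans (surjective?-unfold (ℓ , coarsen w)) (allᶠ-cong ℓ (λ j → true-iff⇒≡ _ _ (to j) (from j)))
    where
    to : ∀ j → anyᶠ n (λ x → lookup (coarsen w) x == j) ≡ true → occurs j w ≡ true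
    to j h with anyᶠ⇒ n _ h
    ... | x , e = subst (λ z → occurs z w ≡ true) (trans (sym (lookup-coarsen w x)) (==⇒≡ _ _ e)) (occurs-lookup w (lookup πv x))
    from : ∀ j → occurs j w ≡ true → anyᶠ n (λ x → lookup (coarsen w) x == j) ≡ true
    from j h with occurs⇒ j w h
    ... | i , refl = ⇒anyᶠ n _ (rep i) (subst (λ z → (z == lookup w i) ≡ true)
                       (sym (trans (lookup-coarsen w (rep i)) (cong (lookup w) (lookup-rep i)))) (==-refl (lookup w i)))

  isOdd-blockSize-coarsen : T (allBlocksOdd? (P , πv)) → ∀ {ℓ} (w : Vec (Fin ℓ) P) j →
    isOdd (blockSize (ℓ , coarsen w) j) ≡ isOdd (fibreSize w j)
  isOdd-blockSize-coarsen odd {ℓ} w j = begin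
    isOdd (blockSize (ℓ , coarsen w) j)             ≡⟨ cong isOdd (blockSize-countᶠ (coarsen w) j) ⟩
    isOdd (countᶠ n (λ x → lookup (coarsen w) x == j)) ≡⟨ isOdd-countᶠ n _ ⟩
    xorSum (λ x → lookup (coarsen w) x == j)         ≡⟨ Parity.sum-cong-≗ (λ x → cong (_== j) (lookup-coarsen w x)) ⟩
    xorSum (λ x → lookup w (lookup πv x) == j)       ≡⟨ xorSum-oddFibres (lookup πv) oddFibres (λ i → lookup w i == j) ⟩
    xorSum (λ i → lookup w i == j)                   ≡⟨ isOdd-fibreSize w j ⟨
    isOdd (fibreSize w j)                            ∎
    where
    open ≡-Reasoning
    oddFibres : ∀ i → xorSum (λ x → lookup πv x == i) ≡ true
    oddFibres i = trans (sym (isOdd-countᶠ n _))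
      (trans (cong isOdd (sym (blockSize-countᶠ πv i))) (allᶠ⇒ P _ (trans (sym (all-allFin P _)) (T⇒≡true odd)) i))

distinct : ∀ {p} → Vec ℕ p → ℕ
distinct [] = 0
distinct (b ∷ u) = if occursℕ b u then distinct u else suc (distinct u)

repeats+distinct : ∀ {p} (u : Vec ℕ p) → repeats u ℕ.+ distinct u ≡ p
repeats+distinct [] = refl
repeats+distinct (b ∷ u) with occursℕ b u
... | true = cong suc (repeats+distinct u)
... | false = trans (ℕP.+-suc (repeats u) (distinct u)) (cong suc (repeats+distinct u))

countᶠ-insert : ∀ Q (a : Fin Q) (h : Fin Q → Bool) →
  countᶠ Q (λ q → (a == q) ∨ h q) ≡ (if h a then countᶠ Q h else suc (countᶠ Q h))
countᶠ-insert (suc Q) Fin.zero h with h Fin.zero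
... | true = refl
... | false = refl
countᶠ-insert (suc Q) (Fin.suc a) h rewrite countᶠ-insert Q a (λ q → h (Fin.suc q)) with h Fin.zero | h (Fin.suc a)
... | true | true = refl
... | true | false = refl
... | false | true = refl
... | false | false = refl

distinct-countᶠ : ∀ {Q p} (v : Vec (Fin Q) p) → distinct (map toℕ v) ≡ countᶠ Q (λ q → occursℕ (toℕ q) (map toℕ v))
distinct-countᶠ {Q} [] = sym (countᶠ-false Q)
distinct-countᶠ {Q} (a ∷ v) rewrite distinct-countᶠ v = sym (countᶠ-insert Q a (λ q → occursℕ (toℕ q) (map toℕ v)))

countᶠ-all : ∀ k (h : Fin k → Bool) → (∀ q → h q ≡ true) → countᶠ k h ≡ k
countᶠ-all zero h e = refl
countᶠ-all (suc k) h e rewrite e Fin.zero = cong suc (countᶠ-all k (λ q → h (Fin.suc q)) (λ q → e (Fin.suc q)))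

repeats-onto : ∀ {Q p} (v : Vec (Fin Q) p) → (∀ q → occursℕ (toℕ q) (map toℕ v) ≡ true) → repeats (map toℕ v) ≡ p ∸ Q
repeats-onto {Q} {p} v hit = begin
  repeats (map toℕ v)                                        ≡⟨ ℕP.m+n∸n≡m (repeats (map toℕ v)) (distinct (map toℕ v)) ⟨
  repeats (map toℕ v) ℕ.+ distinct (map toℕ v) ∸ distinct (map toℕ v) ≡⟨ cong₂ _∸_ (repeats+distinct (map toℕ v)) distinct≡Q ⟩
  p ∸ Q                                                      ∎
  where
  open ≡-Reasoning
  distinct≡Q : distinct (map toℕ v) ≡ Q
  distinct≡Q = trans (distinct-countᶠ v) (countᶠ-all Q _ hit)

-- Reduction of the theorem to signed counts

sumℤ-setCompositions : ∀ n (F : Labelling n → ℤ) (P? : ∀ ℓ (v : Vec (Fin ℓ) n) → Dec (T (surjective? (ℓ , v)))) →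
  sumℤ (List.map F (concatMap (λ ℓ → List.map (ℓ ,_) (filter (P? ℓ) (allVecs ℓ n))) (upTo (suc n))))
  ≡ ∑[ ℓ < suc n ] sumVecs (toℕ ℓ) n (λ v → 𝟙 (surjective? (toℕ ℓ , v)) * F (toℕ ℓ , v))
sumℤ-setCompositions n F P? =
  trans (sumℤ-concatMap F (λ ℓ → List.map (ℓ ,_) (filter (P? ℓ) (allVecs ℓ n))) (upTo (suc n)))
  (trans (sumℤ-applyUpTo (suc n) (λ ℓ → sumℤ (List.map F (List.map (ℓ ,_) (filter (P? ℓ) (allVecs ℓ n))))) (λ k → k))
    (sum-cong-≗ {n = suc n} (λ ℓ → trans (cong sumℤ (sym (LP.map-∘ {g = F} {f = toℕ ℓ ,_} (filter (P? (toℕ ℓ)) (allVecs (toℕ ℓ) n)))))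
      (trans (sumℤ-filter (λ v → surjective? (toℕ ℓ , v)) (P? (toℕ ℓ)) (λ v → F (toℕ ℓ , v)) (allVecs (toℕ ℓ) n))
             (sumℤ-allVecs (toℕ ℓ) n (λ v → 𝟙 (surjective? (toℕ ℓ , v)) * F (toℕ ℓ , v)))))))

𝟙-if : ∀ ℓ (s b : Bool) → 𝟙 s * (if b then -1ℤ ^ ℓ else 0ℤ) ≡ -1ℤ ^ ℓ * 𝟙 (s ∧ b)
𝟙-if ℓ true true = trans (ℤP.*-identityˡ _) (sym (ℤP.*-identityʳ (-1ℤ ^ ℓ)))
𝟙-if ℓ true false = sym (ℤP.*-zeroʳ (-1ℤ ^ ℓ))
𝟙-if ℓ false b = sym (ℤP.*-zeroʳ (-1ℤ ^ ℓ))

module Reduction {m P Q : ℕ} (πv : Vec (Fin P) (suc m)) (ψv : Vec (Fin Q) (suc m))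
  (π-onto : surjective? (P , πv) ≡ true) (π-odd : T (allBlocksOdd? (P , πv)))
  (ψ-union : unionOfBlocks? (P , πv) (Q , ψv) ≡ true) where

  open Coarsening πv π-onto public

  n : ℕ
  n = suc m

  ψ : Labelling n
  ψ = (Q , ψv)

  labelsᶠ : Vec (Fin Q) P
  labelsᶠ = tabulate (λ i → lookup ψv (rep i))

  labels : Vec ℕ P
  labels = map toℕ labelsᶠ

  lookup-labels : ∀ i → lookup labels i ≡ toℕ (lookup ψv (rep i))
  lookup-labels i = trans (VP.lookup-map i toℕ labelsᶠ) (cong toℕ (VP.lookup∘tabulate (λ i → lookup ψv (rep i)) i))

  label-of-point : ∀ x → toℕ (lookup ψv x) ≡ lookup labels (lookup πv x)
  label-of-point x = trans (cong toℕ (unionOfBlocks?⇒ (P , πv) ψ ψ-union x (rep (lookup πv x)) (sym (lookup-rep _))))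
                           (sym (lookup-labels (lookup πv x)))

  repeats-labels : surjective? ψ ≡ true → repeats labels ≡ P ∸ Q
  repeats-labels ψ-onto = repeats-onto labelsᶠ hit
    where
    hit : ∀ q → occursℕ (toℕ q) labels ≡ true
    hit q with surjective?⇒ ψ ψ-onto q
    ... | x , refl = ⇒occursℕ (toℕ (lookup ψv x)) labels (lookup πv x) (sym (label-of-point x))

  runIndex-coarsen : ∀ {ℓ} (w : Vec (Fin ℓ) P) j → oddBefore (ℓ , coarsen w) (toℕ j) ≡ runIndex (blocksOf labels w) j
  runIndex-coarsen {ℓ} w j = trans (oddBefore-countᶠ (coarsen w) (toℕ j))
    (trans (countᶠ-cong ℓ (λ j′ → cong ((toℕ j′ <ᵇ toℕ j) ∧_) (isOdd-blockSize-coarsen π-odd w j′)))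
           (sym (runIndex-tabulate (blockOf labels w) j)))

  labelAt-blocksOf : ∀ {ℓ} (w : Vec (Fin ℓ) P) j → labelAt (blocksOf labels w) j ≡ fibreLabel labels w j
  labelAt-blocksOf w j = cong proj₁ (VP.lookup∘tabulate (blockOf labels w) j)

  module OfMap {k : ℕ} (w : Vec (Fin (suc k)) P) (w-onto : onto w ≡ true) where

    φ : Labelling n
    φ = (suc k , coarsen w)

    L : Vec Block (suc k)
    L = blocksOf labels w

    M : ℕ
    M = oddBefore φ k

    runOf : Fin n → ℕ
    runOf x = runIndex L (lookup w (lookup πv x))

    lastRun : M ≡ runIndex L (fromℕ k)
    lastRun = trans (cong (oddBefore φ) (sym (FP.toℕ-fromℕ k))) (runIndex-coarsen w (fromℕ k))

    blk-Odd : ∀ x → blk (Odd φ) x ≡ clamp (runOf x) M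
    blk-Odd x = trans (VP.lookup-map x (λ j → clamp (oddBefore φ (toℕ j)) M) (coarsen w))
      (cong (λ z → clamp z M) (trans (cong (λ j → oddBefore φ (toℕ j)) (lookup-coarsen w x)) (runIndex-coarsen w (lookup w (lookup πv x)))))

    toℕ-blk-Odd : ∀ x → toℕ (blk (Odd φ) x) ≡ runOf x
    toℕ-blk-Odd x = trans (cong toℕ (blk-Odd x))
      (toℕ-clamp-≤ (runOf x) M (subst (runOf x ≤_) (sym lastRun) (runIndex-≤-last L (lookup w (lookup πv x)))))

    lastBlockOdd?-coarsen : lastBlockOdd? φ ≡ oddAt L (fromℕ k)
    lastBlockOdd?-coarsen = trans (isOdd-blockSize-coarsen π-odd w (fromℕ k))
                                  (sym (cong proj₂ (VP.lookup∘tabulate (blockOf labels w) (fromℕ k))))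

    hit : ∀ j → ∃ λ i → lookup w i ≡ j
    hit j = occurs⇒ j w (allᶠ⇒ (suc k) (λ j → occurs j w) w-onto j)

    factorisation⇒Valid : (∃ λ (g : Vec (Fin Q) (suc M)) → Monotone g × (∀ x → lookup ψv x ≡ lookup g (blk (Odd φ) x))) →
      oddAt L (fromℕ k) ≡ true → Valid labels w ≡ true
    factorisation⇒Valid (g , g-mono , factors) lastOdd =
      cong₂ _∧_ agree (labels-by-runs⇒admissible L H H-mono labelAt≡ lastOdd)
      where
      H : ℕ → ℕ
      H r = toℕ (lookup g (clamp r M))
      H-mono : ∀ r r′ → r ≤ r′ → H r ≤ H r′
      H-mono r r′ le = g-mono (clamp r M) (clamp r′ M) (clamp-mono r r′ M le)
      label≡ : ∀ i → lookup labels i ≡ H (runIndex L (lookup w i))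
      label≡ i = begin
        lookup labels i                       ≡⟨ lookup-labels i ⟩
        toℕ (lookup ψv (rep i))               ≡⟨ cong toℕ (factors (rep i)) ⟩
        toℕ (lookup g (blk (Odd φ) (rep i)))  ≡⟨ cong (λ z → toℕ (lookup g z)) (blk-Odd (rep i)) ⟩
        H (runOf (rep i))                     ≡⟨ cong (λ z → H (runIndex L (lookup w z))) (lookup-rep i) ⟩
        H (runIndex L (lookup w i))           ∎
        where open ≡-Reasoning
      agree : constantOnFibres labels w ≡ true
      agree = ⇒constantOnFibres labels w (λ i i′ e → trans (label≡ i) (trans (cong (λ z → H (runIndex L z)) e) (sym (label≡ i′))))
      labelAt≡ : ∀ j → labelAt L j ≡ H (runIndex L j)
      labelAt≡ j with hit j
      ... | i , refl = trans (labelAt-blocksOf w (lookup w i)) (trans (fibreLabel-lookup labels w agree i) (label≡ i))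

    summand⇒Valid : lastBlockOdd? φ ∧ refinedBy? ψ (Odd φ) ≡ true → Valid labels w ≡ true
    summand⇒Valid h = factorisation⇒Valid (refinedBy?⇒ ψ (Odd φ) (∧≡true⇒ʳ (lastBlockOdd? φ) (refinedBy? ψ (Odd φ)) h))
                                          (trans (sym lastBlockOdd?-coarsen) (∧≡true⇒ˡ (lastBlockOdd? φ) (refinedBy? ψ (Odd φ)) h))

    Valid⇒summand : Valid labels w ≡ true → lastBlockOdd? φ ∧ refinedBy? ψ (Odd φ) ≡ true
    Valid⇒summand h = cong₂ _∧_ (trans lastBlockOdd?-coarsen (admissible⇒lastOdd L adm)) (⇒refinedBy? ψ (Odd φ) g g-mono factors)
      where
      agree : constantOnFibres labels w ≡ true
      agree = ∧≡true⇒ˡ (constantOnFibres labels w) (admissible L) h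
      adm : admissible L ≡ true
      adm = ∧≡true⇒ʳ (constantOnFibres labels w) (admissible L) h
      labelOf : Fin n → ℕ
      labelOf x = labelAt L (lookup w (lookup πv x))
      toℕ-ψ : ∀ x → toℕ (lookup ψv x) ≡ labelOf x
      toℕ-ψ x = trans (label-of-point x) (trans (sym (fibreLabel-lookup labels w agree (lookup πv x))) (sym (labelAt-blocksOf w (lookup w (lookup πv x)))))
      labelOf-mono : ∀ x y → runOf x ≤ runOf y → labelOf x ≤ labelOf y
      labelOf-mono x y = admissible⇒labels-mono L adm (lookup w (lookup πv x)) (lookup w (lookup πv y))
      pick : (r : Fin (suc M)) → Σ (Fin n) (λ x → runOf x ≡ toℕ r)
      pick r with runIndex-onto L (toℕ r) (subst (toℕ r ≤_) lastRun (FP.toℕ≤pred[n] r))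
      ... | j , e with hit j
      ... | i , refl = rep i , trans (cong (λ z → runIndex L (lookup w z)) (lookup-rep i)) e
      g : Vec (Fin Q) (suc M)
      g = tabulate (λ r → lookup ψv (proj₁ (pick r)))
      toℕ-g : ∀ r → toℕ (lookup g r) ≡ labelOf (proj₁ (pick r))
      toℕ-g r = trans (cong toℕ (VP.lookup∘tabulate (λ r → lookup ψv (proj₁ (pick r))) r)) (toℕ-ψ (proj₁ (pick r)))
      g-mono : Monotone g
      g-mono r r′ le = subst₂ _≤_ (sym (toℕ-g r)) (sym (toℕ-g r′))
        (labelOf-mono (proj₁ (pick r)) (proj₁ (pick r′)) (subst₂ _≤_ (sym (proj₂ (pick r))) (sym (proj₂ (pick r′))) le))
      factors : ∀ x → lookup ψv x ≡ lookup g (blk (Odd φ) x)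
      factors x = FP.toℕ-injective (trans (toℕ-ψ x) (trans sameLabel (sym (toℕ-g r))))
        where
        r : Fin (suc M)
        r = blk (Odd φ) x
        y : Fin n
        y = proj₁ (pick r)
        sameRun : runOf x ≡ runOf y
        sameRun = sym (trans (proj₂ (pick r)) (toℕ-blk-Odd x))
        sameLabel : labelOf x ≡ labelOf y
        sameLabel = ℕP.≤-antisym (labelOf-mono x y (ℕP.≤-reflexive sameRun)) (labelOf-mono y x (ℕP.≤-reflexive (sym sameRun)))

    summand≡Valid : (lastBlockOdd? φ ∧ refinedBy? ψ (Odd φ)) ≡ Valid labels w
    summand≡Valid = true-iff⇒≡ (lastBlockOdd? φ ∧ refinedBy? ψ (Odd φ)) (Valid labels w) summand⇒Valid Valid⇒summand

  summand-coarsen : ∀ ℓ (w : Vec (Fin ℓ) P) →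
    𝟙 (surjective? (ℓ , coarsen w) ∧ (lastBlockOdd? (ℓ , coarsen w) ∧ refinedBy? ψ (Odd (ℓ , coarsen w))))
    ≡ 𝟙 (onto w ∧ Valid labels w)
  summand-coarsen zero w = ⊥-elim (FP.¬Fin0 (lookup w (lookup πv Fin.zero)))
  summand-coarsen (suc k) w rewrite surjective?-coarsen w with onto w in w-onto
  ... | false = refl
  ... | true = cong 𝟙 (OfMap.summand≡Valid w w-onto)

  validCount-coarsen : ∀ ℓ →
    sumVecs ℓ n (λ v → 𝟙 (surjective? (ℓ , v) ∧ summand? (P , πv) ψ (ℓ , v))) ≡ validCount ℓ labels
  validCount-coarsen ℓ = begin
    sumVecs ℓ n (λ v → 𝟙 (surjective? (ℓ , v) ∧ (unionOfBlocks? (P , πv) (ℓ , v) ∧ S v)))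
      ≡⟨ sumVecs-cong ℓ n (λ v → 𝟙-∧-middle (surjective? (ℓ , v)) (unionOfBlocks? (P , πv) (ℓ , v)) (S v)) ⟩
    sumVecs ℓ n (λ v → 𝟙 (unionOfBlocks? (P , πv) (ℓ , v)) * 𝟙 (surjective? (ℓ , v) ∧ S v))
      ≡⟨ sumVecs-coarsen ℓ (λ v → 𝟙 (surjective? (ℓ , v) ∧ S v)) ⟨
    sumVecs ℓ P (λ w → 𝟙 (surjective? (ℓ , coarsen w) ∧ S (coarsen w)))
      ≡⟨ sumVecs-cong ℓ P (summand-coarsen ℓ) ⟩
    validCount ℓ labels ∎
    where
    open ≡-Reasoning
    S : Vec (Fin ℓ) n → Bool
    S v = lastBlockOdd? (ℓ , v) ∧ refinedBy? ψ (Odd (ℓ , v))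

  lhsSum≡signedValidCount : lhsSum (P , πv) ψ ≡ signedValidCount (suc n) labels
  lhsSum≡signedValidCount = begin
    lhsSum (P , πv) ψ
      ≡⟨ sumℤ-setCompositions n F _ ⟩
    ∑[ ℓ < suc n ] sumVecs (toℕ ℓ) n (λ v → 𝟙 (surjective? (toℕ ℓ , v)) * F (toℕ ℓ , v))
      ≡⟨ sum-cong-≗ {n = suc n} (λ ℓ → signedTerm (toℕ ℓ)) ⟩
    signedValidCount (suc n) labels ∎
    where
    open ≡-Reasoning
    F : Labelling n → ℤ
    F φ = if summand? (P , πv) ψ φ then -1ℤ ^ len φ else 0ℤ
    signedTerm : ∀ ℓ → sumVecs ℓ n (λ v → 𝟙 (surjective? (ℓ , v)) * F (ℓ , v)) ≡ -1ℤ ^ ℓ * validCount ℓ labels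
    signedTerm ℓ = begin
      sumVecs ℓ n (λ v → 𝟙 (surjective? (ℓ , v)) * F (ℓ , v))
        ≡⟨ sumVecs-cong ℓ n (λ v → 𝟙-if ℓ (surjective? (ℓ , v)) (summand? (P , πv) ψ (ℓ , v))) ⟩
      sumVecs ℓ n (λ v → -1ℤ ^ ℓ * 𝟙 (surjective? (ℓ , v) ∧ summand? (P , πv) ψ (ℓ , v)))
        ≡⟨ sumVecs-* ℓ n (-1ℤ ^ ℓ) (λ v → 𝟙 (surjective? (ℓ , v) ∧ summand? (P , πv) ψ (ℓ , v))) ⟩
      -1ℤ ^ ℓ * sumVecs ℓ n (λ v → 𝟙 (surjective? (ℓ , v) ∧ summand? (P , πv) ψ (ℓ , v)))
        ≡⟨ cong (-1ℤ ^ ℓ *_) (validCount-coarsen ℓ) ⟩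
      -1ℤ ^ ℓ * validCount ℓ labels ∎

lemma10p3 : (m : ℕ) → (π ψ : Labelling (suc m))
    → IsSetComposition π → T (allBlocksOdd? π)
    → IsSetComposition ψ → T (unionOfBlocks? π ψ)
    → lhsSum π ψ ≡ (+ 2) ^ (len π ∸ len ψ) * (-1ℤ ^ len π)
lemma10p3 m (P , πv) (Q , ψv) π-onto π-odd ψ-onto ψ-union = begin
  lhsSum (P , πv) (Q , ψv)               ≡⟨ lhsSum≡signedValidCount ⟩
  signedValidCount (suc (suc m)) labels  ≡⟨ signedValidCount-formula P labels (suc (suc m)) (s≤s P≤n) ⟩
  (+ 2) ^ repeats labels * -1ℤ ^ P       ≡⟨ cong (λ e → (+ 2) ^ e * -1ℤ ^ P) (repeats-labels (T⇒≡true ψ-onto)) ⟩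
  (+ 2) ^ (P ∸ Q) * -1ℤ ^ P              ∎
  where
  open ≡-Reasoning
  open Reduction πv ψv (T⇒≡true π-onto) π-odd (T⇒≡true ψ-union)
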